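{- Let $k\ge 1$. In the game described in the context (starting from the empty board), Builder has a strategy such that, against every strategy of Painter, at least one of the following occurs: a red $P_3$ or a blue $P_3$ appears within the first $6k-3$ rounds; or after at most $6k-4$ rounds the board contains a bad green $P_{4k-2}$; or after at most $6k-3$ rounds the board contains a good green $P_{4k-2}$.
   Context: $P_m$ denotes the path on $m$ vertices. Game: Builder and Painter play on an infinite vertex set, initially with no edges; in each round Builder draws an edge between two nonadjacent vertices and Painter immediately colors it red, blue or green. A green path is a path all of whose edges are green. A green path is called good if at least one of its endpoints is incident to a red or blue edge, and bad otherwise. -}

module Defs where

open import Data.Nat using (ℕ; zero; suc; _<_)
open import Data.Product using (Σ; ∃; _×_; _,_)
open import Data.Sum using (_⊎_)
open import Data.List using (List; []; _∷_; _∷ʳ_; length)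
open import Data.List.Membership.Propositional using (_∈_)
open import Data.List.Relation.Unary.Unique.Propositional using (Unique)
open import Relation.Binary.PropositionalEquality using (_≡_; _≢_)
open import Relation.Nullary using (¬_)

data Colour : Set where
  red blue green : Colour

-- Vertices are natural numbers (an infinite vertex set).
-- A move: an (undirected) edge {u , v} together with the colour Painter gave it.
Move : Set
Move = ℕ × ℕ × Colour

Board : Set
Board = List Move

BuilderStrategy : Set
BuilderStrategy = Board → ℕ × ℕ

PainterStrategy : Set
PainterStrategy = Board → ℕ × ℕ → Colour

play : BuilderStrategy → PainterStrategy → ℕ → Board
play B P zero = []
play B P (suc n) with play B P n
... | h with B h
...   | (u , v) = h ∷ʳ (u , v , P h (u , v))

EdgeCol : Board → Colour → ℕ → ℕ → Set
EdgeCol h c u v = ((u , v , c) ∈ h) ⊎ ((v , u , c) ∈ h)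

Adjacent : Board → ℕ → ℕ → Set
Adjacent h u v = ∃ λ c → EdgeCol h c u v

Legal : Board → ℕ × ℕ → Set
Legal h (u , v) = (u ≢ v) × ¬ Adjacent h u v

data Walk (h : Board) (c : Colour) : List ℕ → Set where
  single : ∀ v → Walk h c (v ∷ [])
  step   : ∀ u v vs → EdgeCol h c u v → Walk h c (v ∷ vs) → Walk h c (u ∷ v ∷ vs)

MonoPath : Board → Colour → ℕ → List ℕ → Set
MonoPath h c m vs = Walk h c vs × Unique vs × length vs ≡ m

IsEndpoint : List ℕ → ℕ → Set
IsEndpoint vs x = (∃ λ rest → vs ≡ x ∷ rest) ⊎ (∃ λ ini → vs ≡ ini ∷ʳ x)

IncidentNonGreen : Board → ℕ → Set
IncidentNonGreen h x = ∃ λ w → EdgeCol h red x w ⊎ EdgeCol h blue x w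

GoodPath : Board → List ℕ → Set
GoodPath h vs = ∃ λ x → IsEndpoint vs x × IncidentNonGreen h x

BadPath : Board → List ℕ → Set
BadPath h vs = ∀ x → IsEndpoint vs x → ¬ IncidentNonGreen h x

HasMonoP : Board → Colour → ℕ → Set
HasMonoP h c m = ∃ λ vs → MonoPath h c m vs

HasGoodGreenP : Board → ℕ → Set
HasGoodGreenP h m = ∃ λ vs → MonoPath h green m vs × GoodPath h vs

HasBadGreenP : Board → ℕ → Set
HasBadGreenP h m = ∃ λ vs → MonoPath h green m vs × BadPath h vs

-- Builder grows a green path Q, with endpoints a and b, in phases. A phase is played on the current
-- endpoints and ten fresh vertices by a finite decision tree, chosen according to which of a, b already
-- carry a red or a blue edge; each of its branches ends either with a red or blue P₃ or with Q extended
-- by four fresh vertices in total at its two ends. Writing δ = 1 when neither endpoint of Q carries a red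
-- or blue edge and δ = 0 otherwise, a phase ending with path status δ′ takes at most 6 + δ − δ′ rounds,
-- so after n rounds with |Q| = 4m + 2 we keep n + δ ≤ 6m + 3. A three-round opening produces a green P₂,
-- and k − 1 phases then give a green P_{4k−2}; when it is bad, δ = 1 saves a round. The sixteen trees are
-- certified by evaluating a decision procedure.

module Submission where

open import Defs
open import Data.Bool using (Bool; true; false; _∨_; T)
open import Data.Empty using (⊥; ⊥-elim)
open import Data.List using (List; []; _∷_; _++_; _∷ʳ_; length; map; foldl; initLast; _∷ʳ′_)
open import Data.List.Properties
  using (∷-injective; ∷-injectiveˡ; ∷ʳ-injectiveʳ; foldl-∷ʳ; ++-assoc; ++-identityʳ; map-++; map-∘; length-++; length-map)
open import Data.List.Membership.Propositional using (_∈_; find)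
import Data.List.Membership.DecPropositional as DecMembership
open import Data.List.Membership.Propositional.Properties using (∈-++⁺ˡ; ∈-++⁺ʳ; ∈-++⁻; ∈-map⁺; ∈-map⁻)
open import Data.List.Relation.Unary.All as All using (All; []; _∷_; all?)
import Data.List.Relation.Unary.All.Properties as AllP
open import Data.List.Relation.Binary.Disjoint.Propositional using (Disjoint)
open import Data.List.Relation.Unary.Any as Any using (Any; here; there; any?)
open import Data.List.Relation.Unary.Linked as Linked using (Linked; []; [-]; _∷_; linked?)
import Data.List.Relation.Unary.Linked.Properties as LinkedP
open import Data.List.Relation.Unary.Unique.Propositional using (Unique)
import Data.List.Relation.Unary.Unique.Propositional.Properties as Unique
open import Data.List.Relation.Unary.AllPairs using ([]; _∷_)
open import Data.Nat using (ℕ; zero; suc; _+_; _*_; _∸_; _≤_; _<_; _≟_; _≤?_; _<?_; z≤n; s≤s; z<s; s<s)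
open import Data.Nat.Properties
open import Data.Nat.Tactic.RingSolver using (solve-∀)
open import Algebra.Properties.CommutativeSemigroup +-commutativeSemigroup using (x∙yz≈y∙xz)
open import Data.List.Relation.Unary.Unique.DecPropositional _≟_ using (unique?)
open import Data.Product using (Σ; ∃; ∃₂; _×_; _,_; proj₁; proj₂; uncurry)
import Data.Product.Properties as Product
open import Data.Sum as Sum using (_⊎_; inj₁; inj₂; [_,_]′)
open import Data.Unit using (⊤; tt)
open import Function using (_∘′_)
open import Relation.Binary.Definitions using (DecidableEquality)
open import Relation.Binary.PropositionalEquality
open import Relation.Nullary using (¬_; Dec; yes; no; does; proof)
open import Relation.Nullary.Decidable using (True; toWitness; map′; _×-dec_; _⊎-dec_; ¬?; T?)
open import Relation.Nullary.Reflects using (Reflects; ofʸ; ofⁿ; _⊎-reflects_)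

-- Coloured edges over an arbitrary vertex type

Moves : Set → Set
Moves V = List (V × V × Colour)

-- On boards (V = ℕ) this is EdgeCol, definitionally.
Edge : {V : Set} → Moves V → Colour → V → V → Set
Edge h c u v = (u , v , c) ∈ h ⊎ (v , u , c) ∈ h

Touches : {V : Set} → Moves V → Colour → V → Set
Touches h c x = ∃ λ w → Edge h c x w

mapMove : {V W : Set} → (V → W) → V × V × Colour → W × W × Colour
mapMove f (u , v , c) = f u , f v , c

mapMoves : {V W : Set} → (V → W) → Moves V → Moves W
mapMoves f = map (mapMove f)

module _ {V : Set} {h h′ : Moves V} {c : Colour} {u v : V} where

  Edge-++⁺ˡ : Edge h c u v → Edge (h ++ h′) c u v
  Edge-++⁺ˡ = [ inj₁ ∘′ ∈-++⁺ˡ , inj₂ ∘′ ∈-++⁺ˡ ]′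

  Edge-++⁺ʳ : Edge h′ c u v → Edge (h ++ h′) c u v
  Edge-++⁺ʳ = [ inj₁ ∘′ ∈-++⁺ʳ h , inj₂ ∘′ ∈-++⁺ʳ h ]′

  Edge-++⁻ : Edge (h ++ h′) c u v → Edge h c u v ⊎ Edge h′ c u v
  Edge-++⁻ (inj₁ m) = Sum.map inj₁ inj₁ (∈-++⁻ h m)
  Edge-++⁻ (inj₂ m) = Sum.map inj₂ inj₂ (∈-++⁻ h m)

Edge-sym : ∀ {V : Set} {h : Moves V} {c u v} → Edge h c u v → Edge h c v u
Edge-sym = Sum.swap

module _ {V W : Set} (f : V → W) {h : Moves V} {c : Colour} where

  Edge-map⁺ : ∀ {u v} → Edge h c u v → Edge (mapMoves f h) c (f u) (f v)
  Edge-map⁺ = Sum.map (∈-map⁺ (mapMove f)) (∈-map⁺ (mapMove f))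

  Touches-map⁺ : ∀ {x} → Touches h c x → Touches (mapMoves f h) c (f x)
  Touches-map⁺ (w , e) = f w , Edge-map⁺ e

  image-end : ∀ {u w} → Edge (mapMoves f h) c u w → ∃ λ y → w ≡ f y
  image-end (inj₁ m) with (_ , y , _) , _ , eq ← ∈-map⁻ (mapMove f) m = y , cong (proj₁ ∘′ proj₂) eq
  image-end (inj₂ m) with (x , _ , _) , _ , eq ← ∈-map⁻ (mapMove f) m = x , cong proj₁ eq

  module _ (f-injective : ∀ {x y} → f x ≡ f y → x ≡ y) where

    mapMove-injective : ∀ {m m′} → mapMove f m ≡ mapMove f m′ → m ≡ m′
    mapMove-injective eq
      with f-injective (cong proj₁ eq) | f-injective (cong (proj₁ ∘′ proj₂) eq) | cong (proj₂ ∘′ proj₂) eq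
    ... | refl | refl | refl = refl

    ∈-mapMoves⁻ : ∀ m → mapMove f m ∈ mapMoves f h → m ∈ h
    ∈-mapMoves⁻ m m∈ with _ , m′∈ , eq ← ∈-map⁻ (mapMove f) m∈ =
      subst (_∈ h) (sym (mapMove-injective eq)) m′∈

    Edge-map⁻ : ∀ {u v} → Edge (mapMoves f h) c (f u) (f v) → Edge h c u v
    Edge-map⁻ = Sum.map (∈-mapMoves⁻ _) (∈-mapMoves⁻ _)

    Touches-map⁻ : ∀ {x} → Touches (mapMoves f h) c (f x) → Touches h c x
    Touches-map⁻ (_ , e) with y , refl ← image-end e = y , Edge-map⁻ e

_≟ᶜ_ : DecidableEquality Colour
red ≟ᶜ red = yes refl
red ≟ᶜ blue = no λ ()
red ≟ᶜ green = no λ ()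
blue ≟ᶜ red = no λ ()
blue ≟ᶜ blue = yes refl
blue ≟ᶜ green = no λ ()
green ≟ᶜ red = no λ ()
green ≟ᶜ blue = no λ ()
green ≟ᶜ green = yes refl

module DecideEdges {V : Set} (_≟ⱽ_ : DecidableEquality V) where
  open DecMembership (Product.≡-dec _≟ⱽ_ (Product.≡-dec _≟ⱽ_ _≟ᶜ_)) using (_∈?_)

  edge? : ∀ h c u v → Dec (Edge h c u v)
  edge? h c u v = ((u , v , c) ∈? h) ⊎-dec ((v , u , c) ∈? h)

  EndsAt : Colour → V → V × V × Colour → Set
  EndsAt c x (u , v , d) = (u ≡ x ⊎ v ≡ x) × d ≡ c

  Touches⇔Any : ∀ {h c x} → Touches h c x → Any (EndsAt c x) h
  Touches⇔Any (w , inj₁ m) = Any.map (λ { refl → inj₁ refl , refl }) m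
  Touches⇔Any (w , inj₂ m) = Any.map (λ { refl → inj₂ refl , refl }) m

  Any⇒Touches : ∀ {h c x} → Any (EndsAt c x) h → Touches h c x
  Any⇒Touches a with find a
  ... | (u , v , d) , m , inj₁ refl , refl = v , inj₁ m
  ... | (u , v , d) , m , inj₂ refl , refl = u , inj₂ m

  touches? : ∀ h c x → Dec (Touches h c x)
  touches? h c x = map′ Any⇒Touches Touches⇔Any (any? endsAt? h)
    where
      endsAt? : ∀ m → Dec (EndsAt c x m)
      endsAt? (u , v , d) = ((u ≟ⱽ x) ⊎-dec (v ≟ⱽ x)) ×-dec (d ≟ᶜ c)

Reflects-map : ∀ {P Q : Set} {b} → (P → Q) → (Q → P) → Reflects P b → Reflects Q b
Reflects-map f g (ofʸ p) = ofʸ (f p)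
Reflects-map f g (ofⁿ ¬p) = ofⁿ (¬p ∘′ g)

Reflects-witness : ∀ {P : Set} {b} → Reflects P b → T b → P
Reflects-witness (ofʸ p) _ = p

module _ {V : Set} {h h′ : Moves V} {c : Colour} {x : V} where

  Touches-++⁺ : Touches h c x ⊎ Touches h′ c x → Touches (h ++ h′) c x
  Touches-++⁺ (inj₁ (w , e)) = w , Edge-++⁺ˡ e
  Touches-++⁺ (inj₂ (w , e)) = w , Edge-++⁺ʳ e

  Touches-++⁻ : Touches (h ++ h′) c x → Touches h c x ⊎ Touches h′ c x
  Touches-++⁻ (w , e) = Sum.map (w ,_) (w ,_) (Edge-++⁻ e)

Linked-++-shared : ∀ {V : Set} {R : V → V → Set} xs {x ys} →
                   Linked R (xs ∷ʳ x) → Linked R (x ∷ ys) → Linked R (xs ++ x ∷ ys)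
Linked-++-shared [] _ r = r
Linked-++-shared (_ ∷ []) (e ∷ _) r = e ∷ r
Linked-++-shared (_ ∷ _ ∷ xs) (e ∷ l) r = e ∷ Linked-++-shared (_ ∷ xs) l r

Linked⇒Walk : ∀ {h c x xs} → Linked (EdgeCol h c) (x ∷ xs) → Walk h c (x ∷ xs)
Linked⇒Walk {xs = []} [-] = single _
Linked⇒Walk {xs = _ ∷ _} (e ∷ l) = step _ _ _ e (Linked⇒Walk l)

Unique-++-middle : ∀ {V : Set} (xs : List V) {ys zs} → Unique (xs ++ zs) → Unique ys →
                   Disjoint ys (xs ++ zs) → Unique (xs ++ ys ++ zs)
Unique-++-middle [] u uy disj = Unique.++⁺ uy u disj
Unique-++-middle (x ∷ xs) {ys} (x∉ ∷ u) uy disj =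
  AllP.++⁺ (AllP.++⁻ˡ xs x∉)
           (AllP.++⁺ (All.tabulate λ y∈ys x≡y → disj (y∈ys , here (sym x≡y))) (AllP.++⁻ʳ xs x∉))
  ∷ Unique-++-middle xs u uy (λ (y∈ys , y∈) → disj (y∈ys , there y∈))

head≢last : ∀ {V : Set} {xs : List V} {x y r i} → Unique xs → xs ≡ x ∷ r → xs ≡ i ∷ʳ y → 2 ≤ length xs → x ≢ y
head≢last {i = []} _ refl refl (s≤s ())
head≢last {i = _ ∷ i} (x∉r ∷ _) refl eq _ x≡y with refl , r≡ ← ∷-injective eq =
  All.lookup x∉r (subst (_ ∈_) (sym r≡) (∈-++⁺ʳ i (here x≡y))) refl

monoP₃ : ∀ {h c x y z} → EdgeCol h c x y → EdgeCol h c y z → x ≢ y → x ≢ z → y ≢ z → HasMonoP h c 3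
monoP₃ e₁ e₂ x≢y x≢z y≢z =
  _ , step _ _ _ e₁ (step _ _ _ e₂ (single _)) , ((x≢y ∷ x≢z ∷ []) ∷ (y≢z ∷ []) ∷ [] ∷ []) , refl

Reflects-false : ∀ {P : Set} {b} → Reflects P b → ¬ P → b ≡ false
Reflects-false (ofʸ p) ¬p = ⊥-elim (¬p p)
Reflects-false (ofⁿ _) _ = refl

++-mapMoves-∷ʳ : ∀ {V W : Set} (f : V → W) h L m → (h ++ mapMoves f L) ∷ʳ mapMove f m ≡ h ++ mapMoves f (L ∷ʳ m)
++-mapMoves-∷ʳ f h L m = trans (++-assoc h (mapMoves f L) _) (cong (h ++_) (sym (map-++ (mapMove f) L (m ∷ []))))

NonGreen : Colour → Set
NonGreen green = ⊥
NonGreen _ = ⊤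

nonGreen? : ∀ c → Dec (NonGreen c)
nonGreen? red = yes tt
nonGreen? blue = yes tt
nonGreen? green = no λ ()

∃-Colour? : {P : Colour → Set} → (∀ c → Dec (P c)) → Dec (∃ P)
∃-Colour? {P} P? = map′ witness split (P? red ⊎-dec P? blue ⊎-dec P? green)
  where
    witness : P red ⊎ P blue ⊎ P green → ∃ P
    witness (inj₁ p) = red , p
    witness (inj₂ (inj₁ p)) = blue , p
    witness (inj₂ (inj₂ p)) = green , p
    split : ∃ P → P red ⊎ P blue ⊎ P green
    split (red , p) = inj₁ p
    split (blue , p) = inj₂ (inj₁ p)
    split (green , p) = inj₂ (inj₂ p)

data EdgeBelow (f : ℕ) : Move → Set where
  below : ∀ {u v c} → u < f → v < f → EdgeBelow f (u , v , c)

Below : ℕ → Board → Set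
Below f = All (EdgeBelow f)

data NoLoop : Move → Set where
  noLoop : ∀ {u v c} → u ≢ v → NoLoop (u , v , c)

Edge-below : ∀ {f h c x y} → Below f h → EdgeCol h c x y → x < f × y < f
Edge-below h-below (inj₁ m) with below u< v< ← All.lookup h-below m = u< , v<
Edge-below h-below (inj₂ m) with below v< u< ← All.lookup h-below m = u< , v<

Edge-loopless : ∀ {h c x y} → All NoLoop h → EdgeCol h c x y → x ≢ y
Edge-loopless loopless (inj₁ m) with noLoop x≢y ← All.lookup loopless m = x≢y
Edge-loopless loopless (inj₂ m) with noLoop y≢x ← All.lookup loopless m = y≢x ∘′ sym

edgeBelow? : ∀ f m → Dec (EdgeBelow f m)
edgeBelow? f (u , v , _) = map′ (λ (u< , v<) → below u< v<) (λ { (below u< v<) → u< , v< }) (u <? f ×-dec v <? f)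

noLoop? : ∀ m → Dec (NoLoop m)
noLoop? (u , v , _) = map′ noLoop (λ { (noLoop u≢v) → u≢v }) (¬? (u ≟ v))

decideBoard : ∀ f h → {True (all? (edgeBelow? f) h ×-dec all? noLoop? h)} → Below f h × All NoLoop h
decideBoard f h {ok} = toWitness ok

open DecideEdges _≟_ using (touches?)

incident? : ∀ h x → Dec (IncidentNonGreen h x)
incident? h x = map′ (λ { (inj₁ (w , e)) → w , inj₁ e ; (inj₂ (w , e)) → w , inj₂ e })
                     (λ { (w , inj₁ e) → inj₁ (w , e) ; (w , inj₂ e) → inj₂ (w , e) })
                     (touches? h red x ⊎-dec touches? h blue x)

HasP3 : Board → Set
HasP3 h = HasMonoP h red 3 ⊎ HasMonoP h blue 3

nonGreen-P3 : ∀ {h} c → NonGreen c → HasMonoP h c 3 → HasP3 h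
nonGreen-P3 red _ = inj₁
nonGreen-P3 blue _ = inj₂

-- Certified phase strategies

-- Vertices named relative to a phase: A and B stand for the endpoints a and b of its path, N i for
-- the fresh vertex fresh + i.
data Loc : Set where
  A B : Loc
  N : ℕ → Loc

N-injective : ∀ {i j} → N i ≡ N j → i ≡ j
N-injective refl = refl

_≟ᴸ_ : DecidableEquality Loc
A ≟ᴸ A = yes refl
A ≟ᴸ B = no λ ()
A ≟ᴸ N _ = no λ ()
B ≟ᴸ A = no λ ()
B ≟ᴸ B = yes refl
B ≟ᴸ N _ = no λ ()
N _ ≟ᴸ A = no λ ()
N _ ≟ᴸ B = no λ ()
N i ≟ᴸ N j = map′ (cong N) N-injective (i ≟ j)

open DecideEdges _≟ᴸ_ using () renaming (edge? to edgeᴸ?; touches? to touchesᴸ?)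

phaseWidth : ℕ
phaseWidth = 10

InWindow : Loc → Set
InWindow (N i) = i < phaseWidth
InWindow _ = ⊤

inWindow? : ∀ x → Dec (InWindow x)
inWindow? A = yes tt
inWindow? B = yes tt
inWindow? (N i) = i <? phaseWidth

IsNew : Loc → Set
IsNew (N _) = ⊤
IsNew _ = ⊥

isNew? : ∀ x → Dec (IsNew x)
isNew? A = no λ ()
isNew? B = no λ ()
isNew? (N _) = yes tt

IsEnd : Loc → Set
IsEnd (N _) = ⊥
IsEnd _ = ⊤

isEnd? : ∀ x → Dec (IsEnd x)
isEnd? A = yes tt
isEnd? B = yes tt
isEnd? (N _) = no λ ()

LMoves : Set
LMoves = Moves Loc

LegalLocal : LMoves → Loc → Loc → Set
LegalLocal L u v = InWindow u × InWindow v × u ≢ v × (IsNew u ⊎ IsNew v) × ¬ (∃ λ c → Edge L c u v)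

legalLocal? : ∀ L u v → Dec (LegalLocal L u v)
legalLocal? L u v = inWindow? u ×-dec inWindow? v ×-dec ¬? (u ≟ᴸ v) ×-dec (isNew? u ⊎-dec isNew? v)
  ×-dec ¬? (∃-Colour? λ c → edgeᴸ? L c u v)

Status : Set
Status = Bool × Bool × Bool × Bool

statusAt : Status → Loc → Colour → Bool
statusAt (x , _ , _ , _) A red = x
statusAt (_ , x , _ , _) A blue = x
statusAt (_ , _ , x , _) B red = x
statusAt (_ , _ , _ , x) B blue = x
statusAt _ _ _ = false

-- The round a phase may spend on top of six when its path starts with two clean endpoints.
bonus : Status → ℕ
bonus (false , false , false , false) = 1
bonus _ = 0

endA : List ℕ → Loc
endA [] = A
endA (i ∷ _) = N i

endB : List ℕ → Loc
endB [] = B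
endB (i ∷ []) = N i
endB (_ ∷ j ∷ js) = endB (j ∷ js)

endB-∷ʳ : ∀ js j → endB (js ∷ʳ j) ≡ N j
endB-∷ʳ [] j = refl
endB-∷ʳ (_ ∷ []) j = refl
endB-∷ʳ (_ ∷ k ∷ js) j = endB-∷ʳ (k ∷ js) j

touchedAfter : Status → LMoves → Loc → Colour → Bool
touchedAfter s L e c = statusAt s e c ∨ does (touchesᴸ? L c e)

newStatus : Status → LMoves → List ℕ → List ℕ → Status
newStatus s L X Y = touchedAfter s L (endA X) red , touchedAfter s L (endA X) blue
                  , touchedAfter s L (endB Y) red , touchedAfter s L (endB Y) blue

-- node u v asks for the edge uv and continues according to its colour (green, red, blue); p3 x y z c
-- ends with the c-coloured path x y z; pp e i c ends with a c-coloured edge between the endpoint e,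
-- which already carried a c-edge, and N i; done X Y ends with the path N X ++ Q ++ N Y.
data Tree : Set where
  node : Loc → Loc → Tree → Tree → Tree → Tree
  p3   : Loc → Loc → Loc → Colour → Tree
  pp   : Loc → ℕ → Colour → Tree
  done : List ℕ → List ℕ → Tree

data IsNode : Tree → Set where
  node : ∀ {u v tg tr tb} → IsNode (node u v tg tr tb)

isNode? : ∀ t → Dec (IsNode t)
isNode? (node _ _ _ _ _) = yes node
isNode? (p3 _ _ _ _) = no λ ()
isNode? (pp _ _ _) = no λ ()
isNode? (done _ _) = no λ ()

Certified : Status → LMoves → Tree → Set
Certified s L (node u v tg tr tb) = LegalLocal L u v × Certified s (L ∷ʳ (u , v , green)) tg
  × Certified s (L ∷ʳ (u , v , red)) tr × Certified s (L ∷ʳ (u , v , blue)) tb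
Certified s L (p3 x y z c) = NonGreen c × Edge L c x y × Edge L c y z × x ≢ y × x ≢ z × y ≢ z
  × length L ≤ 6 + bonus s
Certified s L (pp e i c) = NonGreen c × IsEnd e × T (statusAt s e c) × Edge L c e (N i) × length L ≤ 6 + bonus s
Certified s L (done X Y) = length X + length Y ≡ 4 × Unique (X ++ Y) × All (_< phaseWidth) (X ++ Y)
  × Linked (Edge L green) (map N X ∷ʳ A) × Linked (Edge L green) (B ∷ map N Y)
  × length L + bonus (newStatus s L X Y) ≤ 6 + bonus s

certified? : ∀ s L t → Dec (Certified s L t)
certified? s L (node u v tg tr tb) = legalLocal? L u v ×-dec certified? s _ tg ×-dec certified? s _ tr
  ×-dec certified? s _ tb
certified? s L (p3 x y z c) = nonGreen? c ×-dec edgeᴸ? L c x y ×-dec edgeᴸ? L c y z ×-dec ¬? (x ≟ᴸ y)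
  ×-dec ¬? (x ≟ᴸ z) ×-dec ¬? (y ≟ᴸ z) ×-dec length L ≤? 6 + bonus s
certified? s L (pp e i c) = nonGreen? c ×-dec isEnd? e ×-dec T? (statusAt s e c) ×-dec edgeᴸ? L c e (N i)
  ×-dec length L ≤? 6 + bonus s
certified? s L (done X Y) = (length X + length Y ≟ 4) ×-dec unique? (X ++ Y) ×-dec all? (_<? phaseWidth) (X ++ Y)
  ×-dec linked? (edgeᴸ? L green) (map N X ∷ʳ A) ×-dec linked? (edgeᴸ? L green) (B ∷ map N Y)
  ×-dec length L + bonus (newStatus s L X Y) ≤? 6 + bonus s

Winning : Status → Tree → Set
Winning s t = IsNode t × Certified s [] t

byDecision : ∀ s t → {True (isNode? t ×-dec certified? s [] t)} → Winning s t
byDecision s t {ok} = toWitness ok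

strategy : Status → Tree
strategy (false , false , false , false) = (node A (N 0) (node A (N 1) (node B (N 2) (node (N 0) (N 1) (node (N 0) (N 3) (done (3 ∷ 0 ∷ 1 ∷ []) (2 ∷ [])) (node (N 1) (N 3) (done (3 ∷ 1 ∷ 0 ∷ []) (2 ∷ [])) (p3 (N 0) (N 3) (N 1) red) (node (N 2) (N 3) (done (1 ∷ 0 ∷ []) (2 ∷ 3 ∷ [])) (p3 (N 0) (N 3) (N 2) red) (p3 (N 1) (N 3) (N 2) blue))) (node (N 1) (N 3) (done (3 ∷ 1 ∷ 0 ∷ []) (2 ∷ [])) (node (N 2) (N 3) (done (1 ∷ 0 ∷ []) (2 ∷ 3 ∷ [])) (p3 (N 1) (N 3) (N 2) red) (p3 (N 0) (N 3) (N 2) blue)) (p3 (N 0) (N 3) (N 1) blue))) (node (N 0) (N 2) (node (N 0) (N 3) (done (1 ∷ []) (2 ∷ 0 ∷ 3 ∷ [])) (p3 (N 1) (N 0) (N 3) red) (node (N 0) (N 4) (done (1 ∷ []) (2 ∷ 0 ∷ 4 ∷ [])) (p3 (N 1) (N 0) (N 4) red) (p3 (N 3) (N 0) (N 4) blue))) (p3 (N 1) (N 0) (N 2) red) (node (N 0) (N 3) (node (N 1) (N 2) (done (3 ∷ 0 ∷ []) (2 ∷ 1 ∷ [])) (p3 (N 0) (N 1) (N 2) red) (p3 (N 0) (N 2) (N 1) blue)) (p3 (N 1) (N 0) (N 3) red) (p3 (N 2) (N 0) (N 3) blue))) (node (N 0) (N 2) (node (N 0) (N 3) (done (1 ∷ [])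 (2 ∷ 0 ∷ 3 ∷ [])) (node (N 0) (N 4) (done (1 ∷ []) (2 ∷ 0 ∷ 4 ∷ [])) (p3 (N 3) (N 0) (N 4) red) (p3 (N 1) (N 0) (N 4) blue)) (p3 (N 1) (N 0) (N 3) blue)) (node (N 0) (N 3) (node (N 1) (N 2) (done (3 ∷ 0 ∷ []) (2 ∷ 1 ∷ [])) (p3 (N 0) (N 2) (N 1) red) (p3 (N 0) (N 1) (N 2) blue)) (p3 (N 2) (N 0) (N 3) red) (p3 (N 1) (N 0) (N 3) blue)) (p3 (N 1) (N 0) (N 2) blue))) (node (N 0) (N 2) (node B (N 3) (node (N 1) (N 2) (done (1 ∷ 2 ∷ 0 ∷ []) (3 ∷ [])) (p3 B (N 2) (N 1) red) (node (N 2) (N 3) (done (1 ∷ []) (3 ∷ 2 ∷ 0 ∷ [])) (p3 B (N 2) (N 3) red) (p3 (N 1) (N 2) (N 3) blue))) (p3 (N 2) B (N 3) red) (node B (N 0) (node (N 2) (N 3) (done (1 ∷ []) (0 ∷ 2 ∷ 3 ∷ [])) (p3 B (N 2) (N 3) red) (p3 B (N 3) (N 2) blue)) (p3 (N 2) B (N 0) red) (p3 (N 3) B (N 0) blue))) (p3 B (N 2) (N 0) red) (node B (N 0) (node (N 1) (N 2) (node (N 2) (N 3) (done (3 ∷ 2 ∷ 1 ∷ []) (0 ∷ [])) (p3 B (N 2) (N 3) red) (p3 (N 0) (N 2) (N 3) blue)) (p3 B (N 2) (N 1) red) (p3 (N 0) (N 2) (N 1) blue)) (p3 (N 2) B (N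 0) red) (p3 (N 2) (N 0) B blue))) (node (N 0) (N 2) (node B (N 3) (node (N 1) (N 2) (done (1 ∷ 2 ∷ 0 ∷ []) (3 ∷ [])) (node (N 2) (N 3) (done (1 ∷ []) (3 ∷ 2 ∷ 0 ∷ [])) (p3 (N 1) (N 2) (N 3) red) (p3 B (N 2) (N 3) blue)) (p3 B (N 2) (N 1) blue)) (node B (N 0) (node (N 2) (N 3) (done (1 ∷ []) (0 ∷ 2 ∷ 3 ∷ [])) (p3 B (N 3) (N 2) red) (p3 B (N 2) (N 3) blue)) (p3 (N 3) B (N 0) red) (p3 (N 2) B (N 0) blue)) (p3 (N 2) B (N 3) blue)) (node B (N 0) (node (N 1) (N 2) (node (N 2) (N 3) (done (3 ∷ 2 ∷ 1 ∷ []) (0 ∷ [])) (p3 (N 0) (N 2) (N 3) red) (p3 B (N 2) (N 3) blue)) (p3 (N 0) (N 2) (N 1) red) (p3 B (N 2) (N 1) blue)) (p3 (N 2) (N 0) B red) (p3 (N 2) B (N 0) blue)) (p3 B (N 2) (N 0) blue))) (node B (N 1) (node (N 0) (N 2) (node A (N 3) (node (N 0) (N 1) (done (3 ∷ []) (1 ∷ 0 ∷ 2 ∷ [])) (p3 A (N 1) (N 0) red) (node (N 1) (N 2) (done (3 ∷ []) (1 ∷ 2 ∷ 0 ∷ [])) (p3 A (N 1) (N 2) red) (p3 (N 0) (N 1) (N 2) blue))) (p3 (N 1) A (N 3) red) (node A (N 2) (node (N 1) (N 3) (done (2 ∷ 0 ∷ []) (1 ∷ 3 ∷ [])) (p3 A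 (N 1) (N 3) red) (p3 A (N 3) (N 1) blue)) (p3 (N 1) A (N 2) red) (p3 (N 3) A (N 2) blue))) (node (N 0) (N 3) (node (N 1) (N 2) (done (3 ∷ 0 ∷ []) (1 ∷ 2 ∷ [])) (p3 A (N 1) (N 2) red) (node (N 2) (N 3) (done (2 ∷ 3 ∷ 0 ∷ []) (1 ∷ [])) (p3 (N 0) (N 2) (N 3) red) (p3 (N 1) (N 2) (N 3) blue))) (p3 (N 2) (N 0) (N 3) red) (node (N 0) (N 4) (node (N 1) (N 3) (done (4 ∷ 0 ∷ []) (1 ∷ 3 ∷ [])) (p3 A (N 1) (N 3) red) (p3 (N 0) (N 3) (N 1) blue)) (p3 (N 2) (N 0) (N 4) red) (p3 (N 3) (N 0) (N 4) blue))) (node (N 0) (N 3) (node A (N 2) (node (N 0) (N 1) (done (2 ∷ []) (1 ∷ 0 ∷ 3 ∷ [])) (p3 A (N 1) (N 0) red) (p3 (N 2) (N 0) (N 1) blue)) (p3 (N 1) A (N 2) red) (p3 (N 0) (N 2) A blue)) (node (N 0) (N 4) (node (N 1) (N 2) (done (4 ∷ 0 ∷ []) (1 ∷ 2 ∷ [])) (p3 A (N 1) (N 2) red) (p3 (N 0) (N 2) (N 1) blue)) (p3 (N 3) (N 0) (N 4) red) (p3 (N 2) (N 0) (N 4) blue)) (p3 (N 2) (N 0) (N 3) blue))) (p3 A (N 1) B red) (node B (N 2) (node (N 0) (N 1) (node (N 0) (N 2) (node (N 1) (N 3) (done ([]) (2 ∷ 0 ∷ 1 ∷ 3 ∷ []))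 (p3 A (N 1) (N 3) red) (p3 B (N 1) (N 3) blue)) (node (N 1) (N 3) (done (3 ∷ 1 ∷ 0 ∷ []) (2 ∷ [])) (p3 A (N 1) (N 3) red) (p3 B (N 1) (N 3) blue)) (node (N 1) (N 3) (done (3 ∷ 1 ∷ 0 ∷ []) (2 ∷ [])) (p3 A (N 1) (N 3) red) (p3 B (N 1) (N 3) blue))) (p3 A (N 1) (N 0) red) (p3 B (N 1) (N 0) blue)) (node B (N 3) (node (N 0) (N 1) (node (N 1) (N 2) (done (2 ∷ 1 ∷ 0 ∷ []) (3 ∷ [])) (p3 A (N 1) (N 2) red) (p3 B (N 1) (N 2) blue)) (p3 A (N 1) (N 0) red) (p3 B (N 1) (N 0) blue)) (p3 (N 2) B (N 3) red) (p3 (N 1) B (N 3) blue)) (p3 (N 1) B (N 2) blue))) (node B (N 1) (node (N 0) (N 2) (node A (N 3) (node (N 0) (N 1) (done (3 ∷ []) (1 ∷ 0 ∷ 2 ∷ [])) (node (N 1) (N 2) (done (3 ∷ []) (1 ∷ 2 ∷ 0 ∷ [])) (p3 (N 0) (N 1) (N 2) red) (p3 A (N 1) (N 2) blue)) (p3 A (N 1) (N 0) blue)) (node A (N 2) (node (N 1) (N 3) (done (2 ∷ 0 ∷ []) (1 ∷ 3 ∷ [])) (p3 A (N 3) (N 1) red) (p3 A (N 1) (N 3) blue)) (p3 (N 3) A (N 2) red) (p3 (N 1) A (N 2) blue)) (p3 (N 1) A (N 3) blue)) (node (N 0) (N 3) (node A (N 2) (node (N 0) (N 1) (done (2 ∷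 []) (1 ∷ 0 ∷ 3 ∷ [])) (p3 (N 2) (N 0) (N 1) red) (p3 A (N 1) (N 0) blue)) (p3 (N 0) (N 2) A red) (p3 (N 1) A (N 2) blue)) (p3 (N 2) (N 0) (N 3) red) (node (N 0) (N 4) (node (N 1) (N 2) (done (4 ∷ 0 ∷ []) (1 ∷ 2 ∷ [])) (p3 (N 0) (N 2) (N 1) red) (p3 A (N 1) (N 2) blue)) (p3 (N 2) (N 0) (N 4) red) (p3 (N 3) (N 0) (N 4) blue))) (node (N 0) (N 3) (node (N 1) (N 2) (done (3 ∷ 0 ∷ []) (1 ∷ 2 ∷ [])) (node (N 2) (N 3) (done (2 ∷ 3 ∷ 0 ∷ []) (1 ∷ [])) (p3 (N 1) (N 2) (N 3) red) (p3 (N 0) (N 2) (N 3) blue)) (p3 A (N 1) (N 2) blue)) (node (N 0) (N 4) (node (N 1) (N 3) (done (4 ∷ 0 ∷ []) (1 ∷ 3 ∷ [])) (p3 (N 0) (N 3) (N 1) red) (p3 A (N 1) (N 3) blue)) (p3 (N 3) (N 0) (N 4) red) (p3 (N 2) (N 0) (N 4) blue)) (p3 (N 2) (N 0) (N 3) blue))) (node B (N 2) (node (N 0) (N 1) (node (N 0) (N 2) (node (N 1) (N 3) (done ([]) (2 ∷ 0 ∷ 1 ∷ 3 ∷ [])) (p3 B (N 1) (N 3) red) (p3 A (N 1) (N 3) blue)) (node (N 1) (N 3) (done (3 ∷ 1 ∷ 0 ∷ []) (2 ∷ [])) (p3 B (N 1) (N 3) red) (p3 A (N 1) (N 3) blue))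 (node (N 1) (N 3) (done (3 ∷ 1 ∷ 0 ∷ []) (2 ∷ [])) (p3 B (N 1) (N 3) red) (p3 A (N 1) (N 3) blue))) (p3 B (N 1) (N 0) red) (p3 A (N 1) (N 0) blue)) (p3 (N 1) B (N 2) red) (node B (N 3) (node (N 0) (N 1) (node (N 1) (N 2) (done (2 ∷ 1 ∷ 0 ∷ []) (3 ∷ [])) (p3 B (N 1) (N 2) red) (p3 A (N 1) (N 2) blue)) (p3 B (N 1) (N 0) red) (p3 A (N 1) (N 0) blue)) (p3 (N 1) B (N 3) red) (p3 (N 2) B (N 3) blue))) (p3 A (N 1) B blue))) (node (N 0) (N 1) (node A (N 2) (node B (N 0) (node B (N 3) (node (N 0) (N 2) (done (1 ∷ 0 ∷ 2 ∷ []) (3 ∷ [])) (p3 A (N 0) (N 2) red) (node (N 0) (N 3) (done (2 ∷ []) (3 ∷ 0 ∷ 1 ∷ [])) (p3 A (N 0) (N 3) red) (p3 (N 2) (N 0) (N 3) blue))) (node (N 1) (N 3) (done (2 ∷ []) (0 ∷ 1 ∷ 3 ∷ [])) (p3 B (N 3) (N 1) red) (node (N 2) (N 3) (done (3 ∷ 2 ∷ []) (0 ∷ 1 ∷ [])) (p3 B (N 3) (N 2) red) (p3 (N 1) (N 3) (N 2) blue))) (node B (N 1) (node (N 0) (N 3) (done (2 ∷ []) (1 ∷ 0 ∷ 3 ∷ [])) (p3 A (N 0) (N 3) red) (p3 B (N 3) (N 0) blue)) (node (N 1) (N 3) (done (2 ∷ []) (0 ∷ 1 ∷ 3 ∷ []))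 (p3 B (N 1) (N 3) red) (p3 B (N 3) (N 1) blue)) (p3 (N 3) B (N 1) blue))) (p3 A (N 0) B red) (node B (N 1) (node (N 0) (N 3) (done (2 ∷ []) (1 ∷ 0 ∷ 3 ∷ [])) (p3 A (N 0) (N 3) red) (p3 B (N 0) (N 3) blue)) (node B (N 3) (node (N 0) (N 2) (done (1 ∷ 0 ∷ 2 ∷ []) (3 ∷ [])) (p3 A (N 0) (N 2) red) (p3 B (N 0) (N 2) blue)) (p3 (N 1) B (N 3) red) (p3 (N 0) B (N 3) blue)) (p3 (N 0) B (N 1) blue))) (p3 (N 0) A (N 2) red) (node A (N 1) (node B (N 2) (node B (N 3) (node (N 0) (N 2) (done (2 ∷ 0 ∷ 1 ∷ []) (3 ∷ [])) (p3 A (N 0) (N 2) red) (p3 A (N 2) (N 0) blue)) (node (N 2) (N 3) (done (0 ∷ 1 ∷ []) (2 ∷ 3 ∷ [])) (p3 B (N 3) (N 2) red) (p3 A (N 2) (N 3) blue)) (node (N 0) (N 3) (done (3 ∷ 0 ∷ 1 ∷ []) (2 ∷ [])) (p3 A (N 0) (N 3) red) (p3 B (N 3) (N 0) blue))) (node (N 0) (N 2) (node (N 2) (N 3) (done (3 ∷ 2 ∷ 0 ∷ 1 ∷ []) ([])) (p3 B (N 2) (N 3) red) (p3 A (N 2) (N 3) blue)) (p3 A (N 0) (N 2) red) (p3 A (N 2) (N 0) blue)) (p3 A (N 2) B blue)) (p3 (N 0) A (N 1) red) (p3 (N 2) A (N 1) blue))) (p3 A (N 0) (N 1) red) (node A (N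 1) (node B (N 0) (node (N 1) (N 2) (node A (N 2) (node (N 0) (N 3) (done (1 ∷ 2 ∷ []) (0 ∷ 3 ∷ [])) (p3 A (N 0) (N 3) red) (p3 (N 1) (N 0) (N 3) blue)) (p3 (N 0) A (N 2) red) (node (N 0) (N 3) (done (2 ∷ 1 ∷ []) (0 ∷ 3 ∷ [])) (p3 A (N 0) (N 3) red) (p3 (N 1) (N 0) (N 3) blue))) (node (N 0) (N 2) (node (N 1) (N 3) (done (3 ∷ 1 ∷ []) (0 ∷ 2 ∷ [])) (p3 (N 2) (N 1) (N 3) red) (p3 (N 0) (N 1) (N 3) blue)) (p3 A (N 0) (N 2) red) (p3 (N 1) (N 0) (N 2) blue)) (p3 (N 0) (N 1) (N 2) blue)) (p3 A (N 0) B red) (p3 (N 1) (N 0) B blue)) (p3 (N 0) A (N 1) red) (p3 (N 0) (N 1) A blue))) (node (N 0) (N 1) (node A (N 2) (node B (N 0) (node B (N 3) (node (N 0) (N 2) (done (1 ∷ 0 ∷ 2 ∷ []) (3 ∷ [])) (node (N 0) (N 3) (done (2 ∷ []) (3 ∷ 0 ∷ 1 ∷ [])) (p3 (N 2) (N 0) (N 3) red) (p3 A (N 0) (N 3) blue)) (p3 A (N 0) (N 2) blue)) (node B (N 1) (node (N 0) (N 3) (done (2 ∷ []) (1 ∷ 0 ∷ 3 ∷ [])) (p3 B (N 3) (N 0) red) (p3 A (N 0) (N 3) blue)) (p3 (N 3) B (N 1) red) (node (N 1) (N 3) (done (2 ∷ []) (0 ∷ 1 ∷ 3 ∷ [])) (p3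 B (N 3) (N 1) red) (p3 B (N 1) (N 3) blue))) (node (N 1) (N 3) (done (2 ∷ []) (0 ∷ 1 ∷ 3 ∷ [])) (node (N 2) (N 3) (done (3 ∷ 2 ∷ []) (0 ∷ 1 ∷ [])) (p3 (N 1) (N 3) (N 2) red) (p3 B (N 3) (N 2) blue)) (p3 B (N 3) (N 1) blue))) (node B (N 1) (node (N 0) (N 3) (done (2 ∷ []) (1 ∷ 0 ∷ 3 ∷ [])) (p3 B (N 0) (N 3) red) (p3 A (N 0) (N 3) blue)) (p3 (N 0) B (N 1) red) (node B (N 3) (node (N 0) (N 2) (done (1 ∷ 0 ∷ 2 ∷ []) (3 ∷ [])) (p3 B (N 0) (N 2) red) (p3 A (N 0) (N 2) blue)) (p3 (N 0) B (N 3) red) (p3 (N 1) B (N 3) blue))) (p3 A (N 0) B blue)) (node A (N 1) (node B (N 2) (node B (N 3) (node (N 0) (N 2) (done (2 ∷ 0 ∷ 1 ∷ []) (3 ∷ [])) (p3 A (N 2) (N 0) red) (p3 A (N 0) (N 2) blue)) (node (N 0) (N 3) (done (3 ∷ 0 ∷ 1 ∷ []) (2 ∷ [])) (p3 B (N 3) (N 0) red) (p3 A (N 0) (N 3) blue)) (node (N 2) (N 3) (done (0 ∷ 1 ∷ []) (2 ∷ 3 ∷ [])) (p3 A (N 2) (N 3) red) (p3 B (N 3) (N 2) blue))) (p3 A (N 2) B red) (node (N 0) (N 2) (node (N 2) (N 3) (done (3 ∷ 2 ∷ 0 ∷ 1 ∷ []) ([])) (p3 A (N 2) (N 3) red) (p3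 B (N 2) (N 3) blue)) (p3 A (N 2) (N 0) red) (p3 A (N 0) (N 2) blue))) (p3 (N 2) A (N 1) red) (p3 (N 0) A (N 1) blue)) (p3 (N 0) A (N 2) blue)) (node A (N 1) (node B (N 0) (node (N 1) (N 2) (node A (N 2) (node (N 0) (N 3) (done (1 ∷ 2 ∷ []) (0 ∷ 3 ∷ [])) (p3 (N 1) (N 0) (N 3) red) (p3 A (N 0) (N 3) blue)) (node (N 0) (N 3) (done (2 ∷ 1 ∷ []) (0 ∷ 3 ∷ [])) (p3 (N 1) (N 0) (N 3) red) (p3 A (N 0) (N 3) blue)) (p3 (N 0) A (N 2) blue)) (p3 (N 0) (N 1) (N 2) red) (node (N 0) (N 2) (node (N 1) (N 3) (done (3 ∷ 1 ∷ []) (0 ∷ 2 ∷ [])) (p3 (N 0) (N 1) (N 3) red) (p3 (N 2) (N 1) (N 3) blue)) (p3 (N 1) (N 0) (N 2) red) (p3 A (N 0) (N 2) blue))) (p3 (N 1) (N 0) B red) (p3 A (N 0) B blue)) (p3 (N 0) (N 1) A red) (p3 (N 0) A (N 1) blue)) (p3 A (N 0) (N 1) blue)))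
strategy (false , false , false , true) = (node (N 0) (N 1) (node A (N 2) (node B (N 0) (node (N 0) (N 3) (node B (N 1) (done (2 ∷ []) (1 ∷ 0 ∷ 3 ∷ [])) (node B (N 3) (done (2 ∷ []) (3 ∷ 0 ∷ 1 ∷ [])) (p3 (N 1) B (N 3) red) (pp B 3 blue)) (pp B 1 blue)) (node (N 0) (N 2) (node B (N 3) (done (1 ∷ 0 ∷ 2 ∷ []) (3 ∷ [])) (p3 (N 0) (N 3) B red) (pp B 3 blue)) (p3 (N 3) (N 0) (N 2) red) (node (N 2) (N 3) (done (3 ∷ 2 ∷ []) (0 ∷ 1 ∷ [])) (p3 (N 0) (N 3) (N 2) red) (p3 (N 0) (N 2) (N 3) blue))) (node (N 1) (N 3) (done (2 ∷ []) (0 ∷ 1 ∷ 3 ∷ [])) (node (N 2) (N 3) (done (3 ∷ 2 ∷ []) (0 ∷ 1 ∷ [])) (p3 (N 1) (N 3) (N 2) red) (p3 (N 0) (N 3) (N 2) blue)) (p3 (N 0) (N 3) (N 1) blue))) (node B (N 3) (node (N 0) (N 2) (done (1 ∷ 0 ∷ 2 ∷ []) (3 ∷ [])) (p3 B (N 0) (N 2) red) (node (N 0) (N 3) (done (2 ∷ []) (3 ∷ 0 ∷ 1 ∷ [])) (p3 B (N 0) (N 3) red) (p3 (N 2) (N 0) (N 3) blue))) (p3 (N 0) B (N 3) red) (pp B 3 blue)) (pp B 0 blue)) (node A (N 3) (node B (N 2) (node (N 0) (N 2) (done (3 ∷ []) (2 ∷ 0 ∷ 1 ∷ [])) (p3 A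 (N 2) (N 0) red) (node (N 1) (N 2) (done (3 ∷ []) (2 ∷ 1 ∷ 0 ∷ [])) (p3 A (N 2) (N 1) red) (p3 (N 0) (N 2) (N 1) blue))) (p3 A (N 2) B red) (pp B 2 blue)) (p3 (N 2) A (N 3) red) (node A (N 0) (node B (N 2) (node (N 2) (N 3) (done (1 ∷ 0 ∷ []) (2 ∷ 3 ∷ [])) (p3 A (N 2) (N 3) red) (p3 A (N 3) (N 2) blue)) (p3 A (N 2) B red) (pp B 2 blue)) (p3 (N 2) A (N 0) red) (p3 (N 3) A (N 0) blue))) (node A (N 3) (node B (N 0) (node (N 1) (N 2) (done (3 ∷ []) (0 ∷ 1 ∷ 2 ∷ [])) (node (N 2) (N 3) (done (2 ∷ 3 ∷ []) (0 ∷ 1 ∷ [])) (p3 (N 1) (N 2) (N 3) red) (p3 A (N 2) (N 3) blue)) (p3 A (N 2) (N 1) blue)) (node B (N 1) (node (N 0) (N 2) (done (3 ∷ []) (1 ∷ 0 ∷ 2 ∷ [])) (p3 B (N 0) (N 2) red) (p3 A (N 2) (N 0) blue)) (p3 (N 0) B (N 1) red) (pp B 1 blue)) (pp B 0 blue)) (node A (N 0) (node B (N 3) (node (N 2) (N 3) (done (1 ∷ 0 ∷ []) (3 ∷ 2 ∷ [])) (p3 A (N 3) (N 2) red) (p3 A (N 2) (N 3) blue)) (p3 A (N 3) B red) (pp B 3 blue)) (p3 (N 3) A (N 0) red) (p3 (N 2) A (N 0) blue)) (p3 (N 2) A (N 3) blue))) (node B (N 0) (node (N 1) (N 2) (node (N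 0) (N 3) (node A (N 1) (done (2 ∷ 1 ∷ []) (0 ∷ 3 ∷ [])) (p3 (N 0) (N 1) A red) (node (N 1) (N 3) (done ([]) (0 ∷ 3 ∷ 1 ∷ 2 ∷ [])) (p3 (N 0) (N 1) (N 3) red) (p3 A (N 1) (N 3) blue))) (p3 (N 1) (N 0) (N 3) red) (node (N 0) (N 2) (node (N 1) (N 3) (done ([]) (0 ∷ 2 ∷ 1 ∷ 3 ∷ [])) (p3 (N 0) (N 1) (N 3) red) (p3 (N 0) (N 3) (N 1) blue)) (p3 (N 1) (N 0) (N 2) red) (p3 (N 3) (N 0) (N 2) blue))) (p3 (N 0) (N 1) (N 2) red) (node A (N 1) (node (N 0) (N 2) (node (N 1) (N 3) (done (3 ∷ 1 ∷ []) (0 ∷ 2 ∷ [])) (p3 (N 0) (N 1) (N 3) red) (p3 (N 2) (N 1) (N 3) blue)) (p3 (N 1) (N 0) (N 2) red) (p3 (N 1) (N 2) (N 0) blue)) (p3 (N 0) (N 1) A red) (p3 (N 2) (N 1) A blue))) (p3 (N 1) (N 0) B red) (pp B 0 blue)) (node (N 0) (N 2) (node A (N 1) (node B (N 2) (node (N 0) (N 3) (done (1 ∷ []) (2 ∷ 0 ∷ 3 ∷ [])) (node (N 0) (N 4) (done (1 ∷ []) (2 ∷ 0 ∷ 4 ∷ [])) (p3 (N 3) (N 0) (N 4) red) (p3 (N 1) (N 0) (N 4) blue)) (p3 (N 1) (N 0) (N 3) blue)) (node B (N 3) (node (N 1) (N 2) (done (0 ∷ 2 ∷ 1 ∷ [])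 (3 ∷ [])) (p3 B (N 2) (N 1) red) (p3 (N 0) (N 1) (N 2) blue)) (p3 (N 2) B (N 3) red) (pp B 3 blue)) (pp B 2 blue)) (node A (N 0) (node (N 1) (N 2) (node (N 1) (N 3) (done (3 ∷ 1 ∷ 2 ∷ 0 ∷ []) ([])) (p3 A (N 1) (N 3) red) (p3 (N 0) (N 1) (N 3) blue)) (p3 A (N 1) (N 2) red) (p3 (N 0) (N 1) (N 2) blue)) (p3 (N 1) A (N 0) red) (p3 (N 1) (N 0) A blue)) (p3 (N 0) (N 1) A blue)) (node A (N 0) (node B (N 2) (node (N 0) (N 3) (node (N 1) (N 2) (done (3 ∷ 0 ∷ []) (2 ∷ 1 ∷ [])) (p3 (N 0) (N 2) (N 1) red) (p3 (N 0) (N 1) (N 2) blue)) (p3 (N 2) (N 0) (N 3) red) (p3 (N 1) (N 0) (N 3) blue)) (p3 (N 0) (N 2) B red) (pp B 2 blue)) (p3 (N 2) (N 0) A red) (p3 (N 1) (N 0) A blue)) (p3 (N 1) (N 0) (N 2) blue)))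
strategy (false , false , true , false) = (node (N 0) (N 1) (node A (N 2) (node B (N 0) (node (N 0) (N 3) (node B (N 1) (done (2 ∷ []) (1 ∷ 0 ∷ 3 ∷ [])) (pp B 1 red) (node B (N 3) (done (2 ∷ []) (3 ∷ 0 ∷ 1 ∷ [])) (pp B 3 red) (p3 (N 1) B (N 3) blue))) (node (N 1) (N 3) (done (2 ∷ []) (0 ∷ 1 ∷ 3 ∷ [])) (p3 (N 0) (N 3) (N 1) red) (node (N 2) (N 3) (done (3 ∷ 2 ∷ []) (0 ∷ 1 ∷ [])) (p3 (N 0) (N 3) (N 2) red) (p3 (N 1) (N 3) (N 2) blue))) (node (N 0) (N 2) (node B (N 3) (done (1 ∷ 0 ∷ 2 ∷ []) (3 ∷ [])) (pp B 3 red) (p3 (N 0) (N 3) B blue)) (node (N 2) (N 3) (done (3 ∷ 2 ∷ []) (0 ∷ 1 ∷ [])) (p3 (N 0) (N 2) (N 3) red) (p3 (N 0) (N 3) (N 2) blue)) (p3 (N 3) (N 0) (N 2) blue))) (pp B 0 red) (node B (N 3) (node (N 0) (N 2) (done (1 ∷ 0 ∷ 2 ∷ []) (3 ∷ [])) (node (N 0) (N 3) (done (2 ∷ []) (3 ∷ 0 ∷ 1 ∷ [])) (p3 (N 2) (N 0) (N 3) red) (p3 B (N 0) (N 3) blue)) (p3 B (N 0) (N 2) blue)) (pp B 3 red) (p3 (N 0) B (N 3) blue))) (node A (N 3) (node B (N 0) (node (N 1) (N 2) (done (3 ∷ []) (0 ∷ 1 ∷ 2 ∷ [])) (p3 A (N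 2) (N 1) red) (node (N 2) (N 3) (done (2 ∷ 3 ∷ []) (0 ∷ 1 ∷ [])) (p3 A (N 2) (N 3) red) (p3 (N 1) (N 2) (N 3) blue))) (pp B 0 red) (node B (N 1) (node (N 0) (N 2) (done (3 ∷ []) (1 ∷ 0 ∷ 2 ∷ [])) (p3 A (N 2) (N 0) red) (p3 B (N 0) (N 2) blue)) (pp B 1 red) (p3 (N 0) B (N 1) blue))) (p3 (N 2) A (N 3) red) (node A (N 0) (node B (N 3) (node (N 2) (N 3) (done (1 ∷ 0 ∷ []) (3 ∷ 2 ∷ [])) (p3 A (N 2) (N 3) red) (p3 A (N 3) (N 2) blue)) (pp B 3 red) (p3 A (N 3) B blue)) (p3 (N 2) A (N 0) red) (p3 (N 3) A (N 0) blue))) (node A (N 3) (node B (N 2) (node (N 0) (N 2) (done (3 ∷ []) (2 ∷ 0 ∷ 1 ∷ [])) (node (N 1) (N 2) (done (3 ∷ []) (2 ∷ 1 ∷ 0 ∷ [])) (p3 (N 0) (N 2) (N 1) red) (p3 A (N 2) (N 1) blue)) (p3 A (N 2) (N 0) blue)) (pp B 2 red) (p3 A (N 2) B blue)) (node A (N 0) (node B (N 2) (node (N 2) (N 3) (done (1 ∷ 0 ∷ []) (2 ∷ 3 ∷ [])) (p3 A (N 3) (N 2) red) (p3 A (N 2) (N 3) blue)) (pp B 2 red) (p3 A (N 2) B blue)) (p3 (N 3) A (N 0) red) (p3 (N 2) A (N 0) blue)) (p3 (N 2) A (N 3) blue))) (node (N 0) (N 2) (node A (N 1) (node B (N 2)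 (node (N 0) (N 3) (done (1 ∷ []) (2 ∷ 0 ∷ 3 ∷ [])) (p3 (N 1) (N 0) (N 3) red) (node (N 0) (N 4) (done (1 ∷ []) (2 ∷ 0 ∷ 4 ∷ [])) (p3 (N 1) (N 0) (N 4) red) (p3 (N 3) (N 0) (N 4) blue))) (pp B 2 red) (node B (N 3) (node (N 1) (N 2) (done (0 ∷ 2 ∷ 1 ∷ []) (3 ∷ [])) (p3 (N 0) (N 1) (N 2) red) (p3 B (N 2) (N 1) blue)) (pp B 3 red) (p3 (N 2) B (N 3) blue))) (p3 (N 0) (N 1) A red) (node A (N 0) (node (N 1) (N 2) (node (N 1) (N 3) (done (3 ∷ 1 ∷ 2 ∷ 0 ∷ []) ([])) (p3 (N 0) (N 1) (N 3) red) (p3 A (N 1) (N 3) blue)) (p3 (N 0) (N 1) (N 2) red) (p3 A (N 1) (N 2) blue)) (p3 (N 1) (N 0) A red) (p3 (N 1) A (N 0) blue))) (p3 (N 1) (N 0) (N 2) red) (node A (N 0) (node B (N 2) (node (N 0) (N 3) (node (N 1) (N 2) (done (3 ∷ 0 ∷ []) (2 ∷ 1 ∷ [])) (p3 (N 0) (N 1) (N 2) red) (p3 (N 0) (N 2) (N 1) blue)) (p3 (N 1) (N 0) (N 3) red) (p3 (N 2) (N 0) (N 3) blue)) (pp B 2 red) (p3 (N 0) (N 2) B blue)) (p3 (N 1) (N 0) A red) (p3 (N 2) (N 0) A blue))) (node B (N 0) (node (N 1) (N 2) (node (N 0) (N 3) (node A (N 1) (done (2 ∷ 1 ∷ []) (0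 ∷ 3 ∷ [])) (node (N 1) (N 3) (done ([]) (0 ∷ 3 ∷ 1 ∷ 2 ∷ [])) (p3 A (N 1) (N 3) red) (p3 (N 0) (N 1) (N 3) blue)) (p3 (N 0) (N 1) A blue)) (node (N 0) (N 2) (node (N 1) (N 3) (done ([]) (0 ∷ 2 ∷ 1 ∷ 3 ∷ [])) (p3 (N 0) (N 3) (N 1) red) (p3 (N 0) (N 1) (N 3) blue)) (p3 (N 3) (N 0) (N 2) red) (p3 (N 1) (N 0) (N 2) blue)) (p3 (N 1) (N 0) (N 3) blue)) (node A (N 1) (node (N 0) (N 2) (node (N 1) (N 3) (done (3 ∷ 1 ∷ []) (0 ∷ 2 ∷ [])) (p3 (N 2) (N 1) (N 3) red) (p3 (N 0) (N 1) (N 3) blue)) (p3 (N 1) (N 2) (N 0) red) (p3 (N 1) (N 0) (N 2) blue)) (p3 (N 2) (N 1) A red) (p3 (N 0) (N 1) A blue)) (p3 (N 0) (N 1) (N 2) blue)) (pp B 0 red) (p3 (N 1) (N 0) B blue)))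
strategy (false , false , true , true) = (node B (N 0) (node A (N 1) (node (N 0) (N 2) (node (N 0) (N 1) (node B (N 3) (done (2 ∷ 0 ∷ 1 ∷ []) (3 ∷ [])) (pp B 3 red) (pp B 3 blue)) (node (N 0) (N 3) (node B (N 2) (done (1 ∷ []) (2 ∷ 0 ∷ 3 ∷ [])) (pp B 2 red) (pp B 2 blue)) (p3 (N 1) (N 0) (N 3) red) (node (N 1) (N 3) (done (3 ∷ 1 ∷ []) (0 ∷ 2 ∷ [])) (p3 (N 0) (N 1) (N 3) red) (p3 (N 0) (N 3) (N 1) blue))) (node (N 0) (N 3) (node B (N 2) (done (1 ∷ []) (2 ∷ 0 ∷ 3 ∷ [])) (pp B 2 red) (pp B 2 blue)) (node (N 1) (N 3) (done (3 ∷ 1 ∷ []) (0 ∷ 2 ∷ [])) (p3 (N 0) (N 3) (N 1) red) (p3 (N 0) (N 1) (N 3) blue)) (p3 (N 1) (N 0) (N 3) blue))) (node (N 2) (N 3) (node (N 0) (N 1) (node B (N 2) (done (0 ∷ 1 ∷ []) (2 ∷ 3 ∷ [])) (p3 (N 0) (N 2) B red) (pp B 2 blue)) (p3 (N 2) (N 0) (N 1) red) (node (N 0) (N 3) (done (1 ∷ []) (0 ∷ 3 ∷ 2 ∷ [])) (p3 (N 2) (N 0) (N 3) red) (p3 (N 1) (N 0) (N 3) blue))) (p3 (N 0) (N 2) (N 3) red) (node (N 0) (N 3) (node (N 1) (N 2) (done (2 ∷ 1 ∷ []) (0 ∷ 3 ∷ [])) (p3 (N 0) (N 2) (N 1) red)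 (p3 (N 3) (N 2) (N 1) blue)) (p3 (N 2) (N 0) (N 3) red) (p3 (N 2) (N 3) (N 0) blue))) (node (N 2) (N 3) (node (N 0) (N 1) (node B (N 2) (done (0 ∷ 1 ∷ []) (2 ∷ 3 ∷ [])) (pp B 2 red) (p3 (N 0) (N 2) B blue)) (node (N 0) (N 3) (done (1 ∷ []) (0 ∷ 3 ∷ 2 ∷ [])) (p3 (N 1) (N 0) (N 3) red) (p3 (N 2) (N 0) (N 3) blue)) (p3 (N 2) (N 0) (N 1) blue)) (node (N 0) (N 3) (node (N 1) (N 2) (done (2 ∷ 1 ∷ []) (0 ∷ 3 ∷ [])) (p3 (N 3) (N 2) (N 1) red) (p3 (N 0) (N 2) (N 1) blue)) (p3 (N 2) (N 3) (N 0) red) (p3 (N 2) (N 0) (N 3) blue)) (p3 (N 0) (N 2) (N 3) blue))) (node (N 1) (N 2) (node A (N 3) (node (N 0) (N 1) (done (3 ∷ []) (0 ∷ 1 ∷ 2 ∷ [])) (p3 A (N 1) (N 0) red) (node (N 1) (N 3) (done (2 ∷ 1 ∷ 3 ∷ []) (0 ∷ [])) (p3 A (N 1) (N 3) red) (p3 (N 0) (N 1) (N 3) blue))) (p3 (N 1) A (N 3) red) (node A (N 2) (node (N 1) (N 3) (done (3 ∷ 1 ∷ 2 ∷ []) (0 ∷ [])) (p3 A (N 1) (N 3) red) (p3 A (N 3) (N 1) blue)) (p3 (N 1) A (N 2) red) (p3 (N 3) A (N 2) blue))) (p3 A (N 1) (N 2) red) (node A (N 2) (node (N 0) (N 1) (node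 (N 1) (N 3) (done (2 ∷ []) (0 ∷ 1 ∷ 3 ∷ [])) (p3 A (N 1) (N 3) red) (p3 (N 2) (N 1) (N 3) blue)) (p3 A (N 1) (N 0) red) (p3 (N 2) (N 1) (N 0) blue)) (p3 (N 1) A (N 2) red) (p3 (N 1) (N 2) A blue))) (node (N 1) (N 2) (node A (N 3) (node (N 0) (N 1) (done (3 ∷ []) (0 ∷ 1 ∷ 2 ∷ [])) (node (N 1) (N 3) (done (2 ∷ 1 ∷ 3 ∷ []) (0 ∷ [])) (p3 (N 0) (N 1) (N 3) red) (p3 A (N 1) (N 3) blue)) (p3 A (N 1) (N 0) blue)) (node A (N 2) (node (N 1) (N 3) (done (3 ∷ 1 ∷ 2 ∷ []) (0 ∷ [])) (p3 A (N 3) (N 1) red) (p3 A (N 1) (N 3) blue)) (p3 (N 3) A (N 2) red) (p3 (N 1) A (N 2) blue)) (p3 (N 1) A (N 3) blue)) (node A (N 2) (node (N 0) (N 1) (node (N 1) (N 3) (done (2 ∷ []) (0 ∷ 1 ∷ 3 ∷ [])) (p3 (N 2) (N 1) (N 3) red) (p3 A (N 1) (N 3) blue)) (p3 (N 2) (N 1) (N 0) red) (p3 A (N 1) (N 0) blue)) (p3 (N 1) (N 2) A red) (p3 (N 1) A (N 2) blue)) (p3 A (N 1) (N 2) blue))) (pp B 0 red) (pp B 0 blue))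
strategy (false , true , false , false) = (node (N 0) (N 1) (node A (N 2) (node B (N 0) (node (N 3) (N 4) (node A (N 3) (done (4 ∷ 3 ∷ []) (0 ∷ 1 ∷ [])) (node A (N 4) (done (3 ∷ 4 ∷ []) (0 ∷ 1 ∷ [])) (p3 (N 3) A (N 4) red) (pp A 4 blue)) (pp A 3 blue)) (node (N 1) (N 3) (done (2 ∷ []) (0 ∷ 1 ∷ 3 ∷ [])) (p3 (N 4) (N 3) (N 1) red) (node (N 1) (N 4) (done (2 ∷ []) (0 ∷ 1 ∷ 4 ∷ [])) (p3 (N 3) (N 4) (N 1) red) (p3 (N 3) (N 1) (N 4) blue))) (node (N 1) (N 3) (done (2 ∷ []) (0 ∷ 1 ∷ 3 ∷ [])) (node (N 1) (N 4) (done (2 ∷ []) (0 ∷ 1 ∷ 4 ∷ [])) (p3 (N 3) (N 1) (N 4) red) (p3 (N 3) (N 4) (N 1) blue)) (p3 (N 4) (N 3) (N 1) blue))) (node B (N 3) (node (N 0) (N 2) (done (1 ∷ 0 ∷ 2 ∷ []) (3 ∷ [])) (p3 B (N 0) (N 2) red) (node (N 0) (N 3) (done (2 ∷ []) (3 ∷ 0 ∷ 1 ∷ [])) (p3 B (N 0) (N 3) red) (p3 (N 2) (N 0) (N 3) blue))) (p3 (N 0) B (N 3) red) (node B (N 1) (node (N 0) (N 3) (done (2 ∷ []) (1 ∷ 0 ∷ 3 ∷ [])) (p3 B (N 0) (N 3) red) (p3 B (N 3) (N 0) blue)) (p3 (N 0) B (N 1) red) (p3 (N 3) B (N 1) blue)))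 (node B (N 3) (node (N 0) (N 2) (done (1 ∷ 0 ∷ 2 ∷ []) (3 ∷ [])) (node (N 0) (N 3) (done (2 ∷ []) (3 ∷ 0 ∷ 1 ∷ [])) (p3 (N 2) (N 0) (N 3) red) (p3 B (N 0) (N 3) blue)) (p3 B (N 0) (N 2) blue)) (node B (N 1) (node (N 0) (N 3) (done (2 ∷ []) (1 ∷ 0 ∷ 3 ∷ [])) (p3 B (N 3) (N 0) red) (p3 B (N 0) (N 3) blue)) (p3 (N 3) B (N 1) red) (p3 (N 0) B (N 1) blue)) (p3 (N 0) B (N 3) blue))) (node A (N 3) (node B (N 2) (node (N 0) (N 2) (done (3 ∷ []) (2 ∷ 0 ∷ 1 ∷ [])) (p3 A (N 2) (N 0) red) (node (N 1) (N 2) (done (3 ∷ []) (2 ∷ 1 ∷ 0 ∷ [])) (p3 A (N 2) (N 1) red) (p3 (N 0) (N 2) (N 1) blue))) (p3 A (N 2) B red) (node (N 0) (N 2) (node (N 2) (N 3) (done (1 ∷ 0 ∷ 2 ∷ 3 ∷ []) ([])) (p3 A (N 2) (N 3) red) (p3 B (N 2) (N 3) blue)) (p3 A (N 2) (N 0) red) (p3 B (N 2) (N 0) blue))) (p3 (N 2) A (N 3) red) (pp A 3 blue)) (pp A 2 blue)) (node A (N 0) (node (N 1) (N 2) (node (N 0) (N 3) (node B (N 1) (done (3 ∷ 0 ∷ []) (1 ∷ 2 ∷ [])) (p3 (N 0) (N 1) B red) (node (N 1) (N 3) (done (2 ∷ 1 ∷ 3 ∷ 0 ∷ []) ([])) (p3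 (N 0) (N 1) (N 3) red) (p3 B (N 1) (N 3) blue))) (p3 (N 1) (N 0) (N 3) red) (node (N 0) (N 2) (node (N 1) (N 3) (done (3 ∷ 1 ∷ 2 ∷ 0 ∷ []) ([])) (p3 (N 0) (N 1) (N 3) red) (p3 (N 0) (N 3) (N 1) blue)) (p3 (N 1) (N 0) (N 2) red) (p3 (N 3) (N 0) (N 2) blue))) (p3 (N 0) (N 1) (N 2) red) (node B (N 1) (node (N 0) (N 2) (node (N 1) (N 3) (done (2 ∷ 0 ∷ []) (1 ∷ 3 ∷ [])) (p3 (N 0) (N 1) (N 3) red) (p3 (N 2) (N 1) (N 3) blue)) (p3 (N 1) (N 0) (N 2) red) (p3 (N 1) (N 2) (N 0) blue)) (p3 (N 0) (N 1) B red) (p3 (N 2) (N 1) B blue))) (p3 (N 1) (N 0) A red) (pp A 0 blue)) (node (N 0) (N 2) (node A (N 1) (node (N 0) (N 3) (node (N 1) (N 2) (done (3 ∷ 0 ∷ 2 ∷ 1 ∷ []) ([])) (node (N 1) (N 3) (done (2 ∷ 0 ∷ 3 ∷ 1 ∷ []) ([])) (p3 (N 2) (N 1) (N 3) red) (p3 (N 0) (N 1) (N 3) blue)) (p3 (N 0) (N 1) (N 2) blue)) (node B (N 0) (node (N 1) (N 3) (done (3 ∷ 1 ∷ []) (0 ∷ 2 ∷ [])) (p3 (N 0) (N 3) (N 1) red) (p3 (N 0) (N 1) (N 3) blue)) (p3 (N 3) (N 0) B red) (p3 (N 1) (N 0) B blue)) (p3 (N 1) (N 0) (N 3) blue)) (node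 A (N 2) (node B (N 1) (node (N 1) (N 3) (done (0 ∷ 2 ∷ []) (1 ∷ 3 ∷ [])) (p3 A (N 1) (N 3) red) (p3 (N 0) (N 1) (N 3) blue)) (p3 A (N 1) B red) (p3 (N 0) (N 1) B blue)) (p3 (N 1) A (N 2) red) (pp A 2 blue)) (p3 (N 0) (N 1) A blue)) (node A (N 2) (node B (N 0) (node (N 0) (N 3) (node (N 1) (N 2) (done (1 ∷ 2 ∷ []) (0 ∷ 3 ∷ [])) (p3 (N 0) (N 2) (N 1) red) (p3 (N 0) (N 1) (N 2) blue)) (p3 (N 2) (N 0) (N 3) red) (p3 (N 1) (N 0) (N 3) blue)) (p3 (N 2) (N 0) B red) (p3 (N 1) (N 0) B blue)) (p3 (N 0) (N 2) A red) (pp A 2 blue)) (p3 (N 1) (N 0) (N 2) blue)))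
strategy (false , true , false , true) = (node (N 0) (N 1) (node A (N 2) (node B (N 0) (node (N 0) (N 3) (node B (N 1) (done (2 ∷ []) (1 ∷ 0 ∷ 3 ∷ [])) (node B (N 3) (done (2 ∷ []) (3 ∷ 0 ∷ 1 ∷ [])) (p3 (N 1) B (N 3) red) (pp B 3 blue)) (pp B 1 blue)) (node (N 0) (N 2) (node B (N 3) (done (1 ∷ 0 ∷ 2 ∷ []) (3 ∷ [])) (p3 (N 0) (N 3) B red) (pp B 3 blue)) (p3 (N 3) (N 0) (N 2) red) (node (N 2) (N 3) (done (3 ∷ 2 ∷ []) (0 ∷ 1 ∷ [])) (p3 (N 0) (N 3) (N 2) red) (p3 (N 0) (N 2) (N 3) blue))) (node (N 1) (N 3) (done (2 ∷ []) (0 ∷ 1 ∷ 3 ∷ [])) (node (N 2) (N 3) (done (3 ∷ 2 ∷ []) (0 ∷ 1 ∷ [])) (p3 (N 1) (N 3) (N 2) red) (p3 (N 0) (N 3) (N 2) blue)) (p3 (N 0) (N 3) (N 1) blue))) (node B (N 3) (node (N 0) (N 2) (done (1 ∷ 0 ∷ 2 ∷ []) (3 ∷ [])) (p3 B (N 0) (N 2) red) (node (N 0) (N 3) (done (2 ∷ []) (3 ∷ 0 ∷ 1 ∷ [])) (p3 B (N 0) (N 3) red) (p3 (N 2) (N 0) (N 3) blue))) (p3 (N 0) B (N 3) red) (pp B 3 blue)) (pp B 0 blue)) (node A (N 0) (node (N 1) (N 2) (node B (N 0) (node A (N 3) (done (3 ∷ []) (0 ∷ 1 ∷ 2 ∷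 [])) (p3 (N 2) A (N 3) red) (pp A 3 blue)) (node B (N 3) (done (2 ∷ 1 ∷ 0 ∷ []) (3 ∷ [])) (p3 (N 0) B (N 3) red) (pp B 3 blue)) (pp B 0 blue)) (p3 A (N 2) (N 1) red) (node B (N 2) (node (N 2) (N 3) (done (1 ∷ 0 ∷ []) (2 ∷ 3 ∷ [])) (p3 A (N 2) (N 3) red) (p3 (N 1) (N 2) (N 3) blue)) (p3 A (N 2) B red) (p3 (N 1) (N 2) B blue))) (p3 (N 2) A (N 0) red) (pp A 0 blue)) (pp A 2 blue)) (node A (N 0) (node (N 0) (N 2) (node (N 1) (N 2) (node A (N 3) (node B (N 0) (done (3 ∷ []) (0 ∷ 2 ∷ 1 ∷ [])) (p3 (N 1) (N 0) B red) (pp B 0 blue)) (node B (N 3) (done (1 ∷ 2 ∷ 0 ∷ []) (3 ∷ [])) (p3 A (N 3) B red) (pp B 3 blue)) (pp A 3 blue)) (p3 (N 0) (N 1) (N 2) red) (node B (N 1) (node (N 1) (N 3) (done (2 ∷ 0 ∷ []) (1 ∷ 3 ∷ [])) (p3 (N 0) (N 1) (N 3) red) (p3 (N 2) (N 1) (N 3) blue)) (p3 (N 0) (N 1) B red) (p3 (N 2) (N 1) B blue))) (p3 (N 1) (N 0) (N 2) red) (node B (N 1) (node (N 0) (N 3) (node (N 1) (N 2) (done (3 ∷ 0 ∷ []) (1 ∷ 2 ∷ [])) (p3 (N 0) (N 1) (N 2) red) (p3 (N 0) (N 2) (N 1) blue)) (p3 (N 1) (N 0) (N 3) red) (p3 (N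 2) (N 0) (N 3) blue)) (p3 (N 0) (N 1) B red) (pp B 1 blue))) (p3 (N 1) (N 0) A red) (pp A 0 blue)) (node (N 0) (N 2) (node A (N 1) (node B (N 2) (node (N 0) (N 3) (done (1 ∷ []) (2 ∷ 0 ∷ 3 ∷ [])) (node (N 0) (N 4) (done (1 ∷ []) (2 ∷ 0 ∷ 4 ∷ [])) (p3 (N 3) (N 0) (N 4) red) (p3 (N 1) (N 0) (N 4) blue)) (p3 (N 1) (N 0) (N 3) blue)) (node B (N 3) (node (N 1) (N 2) (done (0 ∷ 2 ∷ 1 ∷ []) (3 ∷ [])) (p3 B (N 2) (N 1) red) (p3 (N 0) (N 1) (N 2) blue)) (p3 (N 2) B (N 3) red) (pp B 3 blue)) (pp B 2 blue)) (node A (N 0) (node (N 1) (N 2) (node (N 1) (N 3) (done (3 ∷ 1 ∷ 2 ∷ 0 ∷ []) ([])) (p3 A (N 1) (N 3) red) (p3 (N 0) (N 1) (N 3) blue)) (p3 A (N 1) (N 2) red) (p3 (N 0) (N 1) (N 2) blue)) (p3 (N 1) A (N 0) red) (p3 (N 1) (N 0) A blue)) (p3 (N 0) (N 1) A blue)) (node A (N 0) (node B (N 2) (node (N 0) (N 3) (node (N 1) (N 2) (done (3 ∷ 0 ∷ []) (2 ∷ 1 ∷ [])) (p3 (N 0) (N 2) (N 1) red) (p3 (N 0) (N 1) (N 2) blue)) (p3 (N 2) (N 0) (N 3) red) (p3 (N 1) (N 0) (N 3) blue)) (p3 (N 0) (N 2) B red) (pp B 2 blue)) (p3 (N 2) (N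 0) A red) (p3 (N 1) (N 0) A blue)) (p3 (N 1) (N 0) (N 2) blue)))
strategy (false , true , true , false) = (node A (N 0) (node B (N 1) (node (N 2) (N 3) (node (N 0) (N 1) (node A (N 2) (done (3 ∷ 2 ∷ []) (1 ∷ 0 ∷ [])) (node A (N 3) (done (2 ∷ 3 ∷ []) (1 ∷ 0 ∷ [])) (p3 (N 2) A (N 3) red) (pp A 3 blue)) (pp A 2 blue)) (node (N 0) (N 2) (done (3 ∷ 2 ∷ 0 ∷ []) (1 ∷ [])) (p3 (N 1) (N 0) (N 2) red) (node (N 0) (N 3) (done (2 ∷ 3 ∷ 0 ∷ []) (1 ∷ [])) (p3 (N 1) (N 0) (N 3) red) (p3 (N 2) (N 0) (N 3) blue))) (node (N 0) (N 2) (done (3 ∷ 2 ∷ 0 ∷ []) (1 ∷ [])) (node (N 0) (N 3) (done (2 ∷ 3 ∷ 0 ∷ []) (1 ∷ [])) (p3 (N 2) (N 0) (N 3) red) (p3 (N 1) (N 0) (N 3) blue)) (p3 (N 1) (N 0) (N 2) blue))) (node (N 0) (N 2) (node (N 0) (N 3) (node A (N 2) (done (3 ∷ 0 ∷ 2 ∷ []) (1 ∷ [])) (p3 (N 3) (N 2) A red) (pp A 2 blue)) (p3 (N 2) (N 3) (N 0) red) (node (N 1) (N 3) (done (2 ∷ 0 ∷ []) (1 ∷ 3 ∷ [])) (p3 (N 2) (N 3) (N 1) red) (p3 (N 0) (N 3) (N 1) blue))) (p3 (N 3) (N 2) (N 0) red) (node (N 0) (N 3) (node (N 1) (N 2) (done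 (3 ∷ 0 ∷ []) (1 ∷ 2 ∷ [])) (p3 (N 3) (N 2) (N 1) red) (p3 (N 0) (N 2) (N 1) blue)) (p3 (N 2) (N 3) (N 0) red) (p3 (N 2) (N 0) (N 3) blue))) (node (N 0) (N 2) (node (N 1) (N 2) (node B (N 3) (done (1 ∷ 2 ∷ 0 ∷ []) (3 ∷ [])) (pp B 3 red) (p3 (N 2) (N 3) B blue)) (node (N 1) (N 3) (done (2 ∷ 0 ∷ []) (1 ∷ 3 ∷ [])) (p3 (N 2) (N 1) (N 3) red) (p3 (N 2) (N 3) (N 1) blue)) (p3 (N 3) (N 2) (N 1) blue)) (node (N 0) (N 3) (node (N 1) (N 2) (done (3 ∷ 0 ∷ []) (1 ∷ 2 ∷ [])) (p3 (N 0) (N 2) (N 1) red) (p3 (N 3) (N 2) (N 1) blue)) (p3 (N 2) (N 0) (N 3) red) (p3 (N 2) (N 3) (N 0) blue)) (p3 (N 3) (N 2) (N 0) blue))) (pp B 1 red) (node (N 0) (N 1) (node (N 1) (N 2) (node B (N 3) (done (2 ∷ 1 ∷ 0 ∷ []) (3 ∷ [])) (pp B 3 red) (p3 (N 1) B (N 3) blue)) (node B (N 2) (node (N 1) (N 3) (done (3 ∷ 1 ∷ 0 ∷ []) (2 ∷ [])) (p3 (N 2) (N 1) (N 3) red) (p3 B (N 1) (N 3) blue)) (p3 (N 1) (N 2) B red) (p3 (N 1) B (N 2) blue)) (p3 B (N 1) (N 2) blue)) (node B (N 2) (node (N 1) (N 2) (node (N 1) (N 3) (done (0 ∷ []) (2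 ∷ 1 ∷ 3 ∷ [])) (p3 (N 0) (N 1) (N 3) red) (p3 B (N 1) (N 3) blue)) (p3 (N 0) (N 1) (N 2) red) (p3 B (N 1) (N 2) blue)) (pp B 2 red) (p3 (N 1) B (N 2) blue)) (p3 B (N 1) (N 0) blue))) (node A (N 1) (node (N 0) (N 2) (node B (N 3) (node (N 0) (N 1) (done (2 ∷ 0 ∷ 1 ∷ []) (3 ∷ [])) (p3 A (N 0) (N 1) red) (node (N 0) (N 3) (done (1 ∷ []) (3 ∷ 0 ∷ 2 ∷ [])) (p3 A (N 0) (N 3) red) (p3 (N 1) (N 0) (N 3) blue))) (pp B 3 red) (node B (N 2) (node (N 0) (N 3) (done (1 ∷ []) (2 ∷ 0 ∷ 3 ∷ [])) (p3 A (N 0) (N 3) red) (p3 B (N 3) (N 0) blue)) (pp B 2 red) (p3 (N 3) B (N 2) blue))) (p3 A (N 0) (N 2) red) (node B (N 2) (node (N 0) (N 1) (node (N 0) (N 3) (done (3 ∷ 0 ∷ 1 ∷ []) (2 ∷ [])) (p3 A (N 0) (N 3) red) (p3 (N 2) (N 0) (N 3) blue)) (p3 A (N 0) (N 1) red) (p3 (N 2) (N 0) (N 1) blue)) (pp B 2 red) (p3 (N 0) (N 2) B blue))) (p3 (N 0) A (N 1) red) (pp A 1 blue)) (pp A 0 blue))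
strategy (false , true , true , true) = (node A (N 0) (node B (N 1) (node (N 0) (N 2) (node (N 0) (N 3) (node A (N 2) (done (3 ∷ 0 ∷ 2 ∷ []) (1 ∷ [])) (node A (N 3) (done (2 ∷ 0 ∷ 3 ∷ []) (1 ∷ [])) (p3 (N 2) A (N 3) red) (pp A 3 blue)) (pp A 2 blue)) (node (N 0) (N 1) (node A (N 3) (done (3 ∷ []) (1 ∷ 0 ∷ 2 ∷ [])) (p3 (N 0) (N 3) A red) (pp A 3 blue)) (p3 (N 3) (N 0) (N 1) red) (node (N 1) (N 3) (done (2 ∷ 0 ∷ []) (1 ∷ 3 ∷ [])) (p3 (N 0) (N 3) (N 1) red) (p3 (N 0) (N 1) (N 3) blue))) (node (N 1) (N 3) (done (2 ∷ 0 ∷ []) (1 ∷ 3 ∷ [])) (node (N 2) (N 3) (done (3 ∷ 2 ∷ 0 ∷ []) (1 ∷ [])) (p3 (N 1) (N 3) (N 2) red) (p3 (N 0) (N 3) (N 2) blue)) (p3 (N 0) (N 3) (N 1) blue))) (node (N 2) (N 3) (node (N 0) (N 1) (node A (N 2) (done (3 ∷ 2 ∷ []) (1 ∷ 0 ∷ [])) (p3 (N 0) (N 2) A red) (pp A 2 blue)) (p3 (N 2) (N 0) (N 1) red) (node (N 0) (N 3) (done (2 ∷ 3 ∷ 0 ∷ []) (1 ∷ [])) (p3 (N 2) (N 0) (N 3) red) (p3 (N 1) (N 0) (N 3) blue))) (p3 (N 0) (N 2) (N 3) red) (node (N 0) (N 3) (node (N 1) (N 2) (done (3 ∷ 0 ∷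 []) (1 ∷ 2 ∷ [])) (p3 (N 0) (N 2) (N 1) red) (p3 (N 3) (N 2) (N 1) blue)) (p3 (N 2) (N 0) (N 3) red) (p3 (N 2) (N 3) (N 0) blue))) (node (N 2) (N 3) (node (N 0) (N 1) (node B (N 3) (done (1 ∷ 0 ∷ []) (3 ∷ 2 ∷ [])) (pp B 3 red) (pp B 3 blue)) (node (N 0) (N 3) (done (2 ∷ 3 ∷ 0 ∷ []) (1 ∷ [])) (p3 (N 1) (N 0) (N 3) red) (p3 (N 2) (N 0) (N 3) blue)) (p3 (N 2) (N 0) (N 1) blue)) (node (N 0) (N 3) (node (N 1) (N 2) (done (3 ∷ 0 ∷ []) (1 ∷ 2 ∷ [])) (p3 (N 3) (N 2) (N 1) red) (p3 (N 0) (N 2) (N 1) blue)) (p3 (N 2) (N 3) (N 0) red) (p3 (N 2) (N 0) (N 3) blue)) (p3 (N 0) (N 2) (N 3) blue))) (pp B 1 red) (pp B 1 blue)) (node A (N 1) (node (N 0) (N 1) (node (N 0) (N 2) (node B (N 3) (done (2 ∷ 0 ∷ 1 ∷ []) (3 ∷ [])) (pp B 3 red) (pp B 3 blue)) (p3 A (N 0) (N 2) red) (node B (N 2) (node (N 0) (N 3) (done (3 ∷ 0 ∷ 1 ∷ []) (2 ∷ [])) (p3 A (N 0) (N 3) red) (p3 (N 2) (N 0) (N 3) blue)) (pp B 2 red) (pp B 2 blue))) (p3 A (N 0) (N 1) red) (node B (N 2) (node (N 0) (N 2) (node (N 0) (N 3) (done (1 ∷ []) (2 ∷ 0 ∷ 3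 ∷ [])) (p3 A (N 0) (N 3) red) (p3 (N 1) (N 0) (N 3) blue)) (p3 A (N 0) (N 2) red) (p3 (N 1) (N 0) (N 2) blue)) (pp B 2 red) (pp B 2 blue))) (p3 (N 0) A (N 1) red) (pp A 1 blue)) (pp A 0 blue))
strategy (true , false , false , false) = (node (N 0) (N 1) (node A (N 2) (node B (N 0) (node (N 3) (N 4) (node A (N 3) (done (4 ∷ 3 ∷ []) (0 ∷ 1 ∷ [])) (pp A 3 red) (node A (N 4) (done (3 ∷ 4 ∷ []) (0 ∷ 1 ∷ [])) (pp A 4 red) (p3 (N 3) A (N 4) blue))) (node (N 1) (N 3) (done (2 ∷ []) (0 ∷ 1 ∷ 3 ∷ [])) (p3 (N 4) (N 3) (N 1) red) (node (N 1) (N 4) (done (2 ∷ []) (0 ∷ 1 ∷ 4 ∷ [])) (p3 (N 3) (N 4) (N 1) red) (p3 (N 3) (N 1) (N 4) blue))) (node (N 1) (N 3) (done (2 ∷ []) (0 ∷ 1 ∷ 3 ∷ [])) (node (N 1) (N 4) (done (2 ∷ []) (0 ∷ 1 ∷ 4 ∷ [])) (p3 (N 3) (N 1) (N 4) red) (p3 (N 3) (N 4) (N 1) blue)) (p3 (N 4) (N 3) (N 1) blue))) (node B (N 3) (node (N 0) (N 2) (done (1 ∷ 0 ∷ 2 ∷ []) (3 ∷ [])) (p3 B (N 0) (N 2) red) (node (N 0) (N 3) (done (2 ∷ []) (3 ∷ 0 ∷ 1 ∷ [])) (p3 B (N 0) (N 3) red) (p3 (N 2) (N 0) (N 3) blue)))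 (p3 (N 0) B (N 3) red) (node B (N 1) (node (N 0) (N 3) (done (2 ∷ []) (1 ∷ 0 ∷ 3 ∷ [])) (p3 B (N 0) (N 3) red) (p3 B (N 3) (N 0) blue)) (p3 (N 0) B (N 1) red) (p3 (N 3) B (N 1) blue))) (node B (N 3) (node (N 0) (N 2) (done (1 ∷ 0 ∷ 2 ∷ []) (3 ∷ [])) (node (N 0) (N 3) (done (2 ∷ []) (3 ∷ 0 ∷ 1 ∷ [])) (p3 (N 2) (N 0) (N 3) red) (p3 B (N 0) (N 3) blue)) (p3 B (N 0) (N 2) blue)) (node B (N 1) (node (N 0) (N 3) (done (2 ∷ []) (1 ∷ 0 ∷ 3 ∷ [])) (p3 B (N 3) (N 0) red) (p3 B (N 0) (N 3) blue)) (p3 (N 3) B (N 1) red) (p3 (N 0) B (N 1) blue)) (p3 (N 0) B (N 3) blue))) (pp A 2 red) (node A (N 3) (node B (N 2) (node (N 0) (N 2) (done (3 ∷ []) (2 ∷ 0 ∷ 1 ∷ [])) (node (N 1) (N 2) (done (3 ∷ []) (2 ∷ 1 ∷ 0 ∷ [])) (p3 (N 0) (N 2) (N 1) red) (p3 A (N 2) (N 1) blue)) (p3 A (N 2) (N 0) blue)) (node (N 0) (N 2) (node (N 2) (N 3) (done (1 ∷ 0 ∷ 2 ∷ 3 ∷ []) ([])) (p3 B (N 2) (N 3) red) (p3 A (N 2) (N 3) blue)) (p3 B (N 2) (N 0) red) (p3 A (N 2) (N 0) blue)) (p3 A (N 2) B blue)) (pp A 3 red) (p3 (N 2) A (N 3)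 blue))) (node (N 0) (N 2) (node A (N 1) (node (N 0) (N 3) (node (N 1) (N 2) (done (3 ∷ 0 ∷ 2 ∷ 1 ∷ []) ([])) (p3 (N 0) (N 1) (N 2) red) (node (N 1) (N 3) (done (2 ∷ 0 ∷ 3 ∷ 1 ∷ []) ([])) (p3 (N 0) (N 1) (N 3) red) (p3 (N 2) (N 1) (N 3) blue))) (p3 (N 1) (N 0) (N 3) red) (node B (N 0) (node (N 1) (N 3) (done (3 ∷ 1 ∷ []) (0 ∷ 2 ∷ [])) (p3 (N 0) (N 1) (N 3) red) (p3 (N 0) (N 3) (N 1) blue)) (p3 (N 1) (N 0) B red) (p3 (N 3) (N 0) B blue))) (p3 (N 0) (N 1) A red) (node A (N 2) (node B (N 1) (node (N 1) (N 3) (done (0 ∷ 2 ∷ []) (1 ∷ 3 ∷ [])) (p3 (N 0) (N 1) (N 3) red) (p3 A (N 1) (N 3) blue)) (p3 (N 0) (N 1) B red) (p3 A (N 1) B blue)) (pp A 2 red) (p3 (N 1) A (N 2) blue))) (p3 (N 1) (N 0) (N 2) red) (node A (N 2) (node B (N 0) (node (N 0) (N 3) (node (N 1) (N 2) (done (1 ∷ 2 ∷ []) (0 ∷ 3 ∷ [])) (p3 (N 0) (N 1) (N 2) red) (p3 (N 0) (N 2) (N 1) blue)) (p3 (N 1) (N 0) (N 3) red) (p3 (N 2) (N 0) (N 3) blue)) (p3 (N 1) (N 0) B red) (p3 (N 2) (N 0) B blue)) (pp A 2 red) (p3 (N 0) (N 2) A blue))) (node A (N 0) (node (N 1) (N 2)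 (node (N 0) (N 3) (node B (N 1) (done (3 ∷ 0 ∷ []) (1 ∷ 2 ∷ [])) (node (N 1) (N 3) (done (2 ∷ 1 ∷ 3 ∷ 0 ∷ []) ([])) (p3 B (N 1) (N 3) red) (p3 (N 0) (N 1) (N 3) blue)) (p3 (N 0) (N 1) B blue)) (node (N 0) (N 2) (node (N 1) (N 3) (done (3 ∷ 1 ∷ 2 ∷ 0 ∷ []) ([])) (p3 (N 0) (N 3) (N 1) red) (p3 (N 0) (N 1) (N 3) blue)) (p3 (N 3) (N 0) (N 2) red) (p3 (N 1) (N 0) (N 2) blue)) (p3 (N 1) (N 0) (N 3) blue)) (node B (N 1) (node (N 0) (N 2) (node (N 1) (N 3) (done (2 ∷ 0 ∷ []) (1 ∷ 3 ∷ [])) (p3 (N 2) (N 1) (N 3) red) (p3 (N 0) (N 1) (N 3) blue)) (p3 (N 1) (N 2) (N 0) red) (p3 (N 1) (N 0) (N 2) blue)) (p3 (N 2) (N 1) B red) (p3 (N 0) (N 1) B blue)) (p3 (N 0) (N 1) (N 2) blue)) (pp A 0 red) (p3 (N 1) (N 0) A blue)))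
strategy (true , false , false , true) = (node A (N 0) (node B (N 1) (node (N 2) (N 3) (node (N 0) (N 1) (node A (N 2) (done (3 ∷ 2 ∷ []) (1 ∷ 0 ∷ [])) (pp A 2 red) (node A (N 3) (done (2 ∷ 3 ∷ []) (1 ∷ 0 ∷ [])) (pp A 3 red) (p3 (N 2) A (N 3) blue))) (node (N 0) (N 2) (done (3 ∷ 2 ∷ 0 ∷ []) (1 ∷ [])) (p3 (N 1) (N 0) (N 2) red) (node (N 0) (N 3) (done (2 ∷ 3 ∷ 0 ∷ []) (1 ∷ [])) (p3 (N 1) (N 0) (N 3) red) (p3 (N 2) (N 0) (N 3) blue))) (node (N 0) (N 2) (done (3 ∷ 2 ∷ 0 ∷ []) (1 ∷ [])) (node (N 0) (N 3) (done (2 ∷ 3 ∷ 0 ∷ []) (1 ∷ [])) (p3 (N 2) (N 0) (N 3) red) (p3 (N 1) (N 0) (N 3) blue)) (p3 (N 1) (N 0) (N 2) blue))) (node (N 0) (N 2) (node (N 1) (N 2) (node B (N 3) (done (1 ∷ 2 ∷ 0 ∷ []) (3 ∷ [])) (p3 (N 2) (N 3) B red) (pp B 3 blue)) (p3 (N 3) (N 2) (N 1) red) (node (N 1) (N 3) (done (2 ∷ 0 ∷ []) (1 ∷ 3 ∷ [])) (p3 (N 2) (N 3) (N 1) red) (p3 (N 2) (N 1) (N 3) blue))) (p3 (N 3) (N 2) (N 0) red) (node (N 0) (N 3) (node (N 1) (N 2) (done (3 ∷ 0 ∷ []) (1 ∷ 2 ∷ [])) (p3 (N 3) (N 2) (N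 1) red) (p3 (N 0) (N 2) (N 1) blue)) (p3 (N 2) (N 3) (N 0) red) (p3 (N 2) (N 0) (N 3) blue))) (node (N 0) (N 2) (node (N 0) (N 3) (node A (N 2) (done (3 ∷ 0 ∷ 2 ∷ []) (1 ∷ [])) (pp A 2 red) (p3 (N 3) (N 2) A blue)) (node (N 1) (N 3) (done (2 ∷ 0 ∷ []) (1 ∷ 3 ∷ [])) (p3 (N 0) (N 3) (N 1) red) (p3 (N 2) (N 3) (N 1) blue)) (p3 (N 2) (N 3) (N 0) blue)) (node (N 0) (N 3) (node (N 1) (N 2) (done (3 ∷ 0 ∷ []) (1 ∷ 2 ∷ [])) (p3 (N 0) (N 2) (N 1) red) (p3 (N 3) (N 2) (N 1) blue)) (p3 (N 2) (N 0) (N 3) red) (p3 (N 2) (N 3) (N 0) blue)) (p3 (N 3) (N 2) (N 0) blue))) (node (N 0) (N 1) (node (N 1) (N 2) (node B (N 3) (done (2 ∷ 1 ∷ 0 ∷ []) (3 ∷ [])) (p3 (N 1) B (N 3) red) (pp B 3 blue)) (p3 B (N 1) (N 2) red) (node B (N 2) (node (N 1) (N 3) (done (3 ∷ 1 ∷ 0 ∷ []) (2 ∷ [])) (p3 B (N 1) (N 3) red) (p3 (N 2) (N 1) (N 3) blue)) (p3 (N 1) B (N 2) red) (p3 (N 1) (N 2) B blue))) (p3 B (N 1) (N 0) red) (node B (N 2) (node (N 1) (N 2) (node (N 1) (N 3) (done (0 ∷ []) (2 ∷ 1 ∷ 3 ∷ [])) (p3 B (N 1) (N 3) red) (p3 (N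 0) (N 1) (N 3) blue)) (p3 B (N 1) (N 2) red) (p3 (N 0) (N 1) (N 2) blue)) (p3 (N 1) B (N 2) red) (pp B 2 blue))) (pp B 1 blue)) (pp A 0 red) (node A (N 1) (node (N 0) (N 2) (node B (N 3) (node (N 0) (N 1) (done (2 ∷ 0 ∷ 1 ∷ []) (3 ∷ [])) (node (N 0) (N 3) (done (1 ∷ []) (3 ∷ 0 ∷ 2 ∷ [])) (p3 (N 1) (N 0) (N 3) red) (p3 A (N 0) (N 3) blue)) (p3 A (N 0) (N 1) blue)) (node B (N 2) (node (N 0) (N 3) (done (1 ∷ []) (2 ∷ 0 ∷ 3 ∷ [])) (p3 B (N 3) (N 0) red) (p3 A (N 0) (N 3) blue)) (p3 (N 3) B (N 2) red) (pp B 2 blue)) (pp B 3 blue)) (node B (N 2) (node (N 0) (N 1) (node (N 0) (N 3) (done (3 ∷ 0 ∷ 1 ∷ []) (2 ∷ [])) (p3 (N 2) (N 0) (N 3) red) (p3 A (N 0) (N 3) blue)) (p3 (N 2) (N 0) (N 1) red) (p3 A (N 0) (N 1) blue)) (p3 (N 0) (N 2) B red) (pp B 2 blue)) (p3 A (N 0) (N 2) blue)) (pp A 1 red) (p3 (N 0) A (N 1) blue)))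
strategy (true , false , true , false) = (node (N 0) (N 1) (node A (N 2) (node B (N 0) (node (N 0) (N 3) (node B (N 1) (done (2 ∷ []) (1 ∷ 0 ∷ 3 ∷ [])) (pp B 1 red) (node B (N 3) (done (2 ∷ []) (3 ∷ 0 ∷ 1 ∷ [])) (pp B 3 red) (p3 (N 1) B (N 3) blue))) (node (N 1) (N 3) (done (2 ∷ []) (0 ∷ 1 ∷ 3 ∷ [])) (p3 (N 0) (N 3) (N 1) red) (node (N 2) (N 3) (done (3 ∷ 2 ∷ []) (0 ∷ 1 ∷ [])) (p3 (N 0) (N 3) (N 2) red) (p3 (N 1) (N 3) (N 2) blue))) (node (N 0) (N 2) (node B (N 3) (done (1 ∷ 0 ∷ 2 ∷ []) (3 ∷ [])) (pp B 3 red) (p3 (N 0) (N 3) B blue)) (node (N 2) (N 3) (done (3 ∷ 2 ∷ []) (0 ∷ 1 ∷ [])) (p3 (N 0) (N 2) (N 3) red) (p3 (N 0) (N 3) (N 2) blue)) (p3 (N 3) (N 0) (N 2) blue))) (pp B 0 red) (node B (N 3) (node (N 0) (N 2) (done (1 ∷ 0 ∷ 2 ∷ []) (3 ∷ [])) (node (N 0) (N 3) (done (2 ∷ []) (3 ∷ 0 ∷ 1 ∷ [])) (p3 (N 2) (N 0) (N 3) red) (p3 B (N 0) (N 3) blue)) (p3 B (N 0) (N 2) blue)) (pp B 3 red) (p3 (N 0) B (N 3) blue))) (pp A 2 red) (node A (N 0) (node (N 1) (N 2) (node B (N 0) (node A (N 3) (done (3 ∷ []) (0 ∷ 1 ∷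 2 ∷ [])) (pp A 3 red) (p3 (N 2) A (N 3) blue)) (pp B 0 red) (node B (N 3) (done (2 ∷ 1 ∷ 0 ∷ []) (3 ∷ [])) (pp B 3 red) (p3 (N 0) B (N 3) blue))) (node B (N 2) (node (N 2) (N 3) (done (1 ∷ 0 ∷ []) (2 ∷ 3 ∷ [])) (p3 (N 1) (N 2) (N 3) red) (p3 A (N 2) (N 3) blue)) (p3 (N 1) (N 2) B red) (p3 A (N 2) B blue)) (p3 A (N 2) (N 1) blue)) (pp A 0 red) (p3 (N 2) A (N 0) blue))) (node (N 0) (N 2) (node A (N 1) (node B (N 2) (node (N 0) (N 3) (done (1 ∷ []) (2 ∷ 0 ∷ 3 ∷ [])) (p3 (N 1) (N 0) (N 3) red) (node (N 0) (N 4) (done (1 ∷ []) (2 ∷ 0 ∷ 4 ∷ [])) (p3 (N 1) (N 0) (N 4) red) (p3 (N 3) (N 0) (N 4) blue))) (pp B 2 red) (node B (N 3) (node (N 1) (N 2) (done (0 ∷ 2 ∷ 1 ∷ []) (3 ∷ [])) (p3 (N 0) (N 1) (N 2) red) (p3 B (N 2) (N 1) blue)) (pp B 3 red) (p3 (N 2) B (N 3) blue))) (p3 (N 0) (N 1) A red) (node A (N 0) (node (N 1) (N 2) (node (N 1) (N 3) (done (3 ∷ 1 ∷ 2 ∷ 0 ∷ []) ([])) (p3 (N 0) (N 1) (N 3) red) (p3 A (N 1) (N 3) blue)) (p3 (N 0) (N 1) (N 2) red) (p3 A (N 1) (N 2) blue)) (p3 (N 1) (N 0) A red) (p3 (N 1)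 A (N 0) blue))) (p3 (N 1) (N 0) (N 2) red) (node A (N 0) (node B (N 2) (node (N 0) (N 3) (node (N 1) (N 2) (done (3 ∷ 0 ∷ []) (2 ∷ 1 ∷ [])) (p3 (N 0) (N 1) (N 2) red) (p3 (N 0) (N 2) (N 1) blue)) (p3 (N 1) (N 0) (N 3) red) (p3 (N 2) (N 0) (N 3) blue)) (pp B 2 red) (p3 (N 0) (N 2) B blue)) (p3 (N 1) (N 0) A red) (p3 (N 2) (N 0) A blue))) (node A (N 0) (node (N 0) (N 2) (node (N 1) (N 2) (node A (N 3) (node B (N 0) (done (3 ∷ []) (0 ∷ 2 ∷ 1 ∷ [])) (pp B 0 red) (p3 (N 1) (N 0) B blue)) (pp A 3 red) (node B (N 3) (done (1 ∷ 2 ∷ 0 ∷ []) (3 ∷ [])) (pp B 3 red) (p3 A (N 3) B blue))) (node B (N 1) (node (N 1) (N 3) (done (2 ∷ 0 ∷ []) (1 ∷ 3 ∷ [])) (p3 (N 2) (N 1) (N 3) red) (p3 (N 0) (N 1) (N 3) blue)) (p3 (N 2) (N 1) B red) (p3 (N 0) (N 1) B blue)) (p3 (N 0) (N 1) (N 2) blue)) (node B (N 1) (node (N 0) (N 3) (node (N 1) (N 2) (done (3 ∷ 0 ∷ []) (1 ∷ 2 ∷ [])) (p3 (N 0) (N 2) (N 1) red) (p3 (N 0) (N 1) (N 2) blue)) (p3 (N 2) (N 0) (N 3) red) (p3 (N 1) (N 0) (N 3) blue)) (pp B 1 red) (p3 (N 0) (N 1) B blue)) (p3 (N 1) (N 0)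 (N 2) blue)) (pp A 0 red) (p3 (N 1) (N 0) A blue)))
strategy (true , false , true , true) = (node A (N 0) (node B (N 1) (node (N 0) (N 2) (node (N 0) (N 3) (node A (N 2) (done (3 ∷ 0 ∷ 2 ∷ []) (1 ∷ [])) (pp A 2 red) (node A (N 3) (done (2 ∷ 0 ∷ 3 ∷ []) (1 ∷ [])) (pp A 3 red) (p3 (N 2) A (N 3) blue))) (node (N 1) (N 3) (done (2 ∷ 0 ∷ []) (1 ∷ 3 ∷ [])) (p3 (N 0) (N 3) (N 1) red) (node (N 2) (N 3) (done (3 ∷ 2 ∷ 0 ∷ []) (1 ∷ [])) (p3 (N 0) (N 3) (N 2) red) (p3 (N 1) (N 3) (N 2) blue))) (node (N 0) (N 1) (node A (N 3) (done (3 ∷ []) (1 ∷ 0 ∷ 2 ∷ [])) (pp A 3 red) (p3 (N 0) (N 3) A blue)) (node (N 1) (N 3) (done (2 ∷ 0 ∷ []) (1 ∷ 3 ∷ [])) (p3 (N 0) (N 1) (N 3) red) (p3 (N 0) (N 3) (N 1) blue)) (p3 (N 3) (N 0) (N 1) blue))) (node (N 2) (N 3) (node (N 0) (N 1) (node B (N 3) (done (1 ∷ 0 ∷ []) (3 ∷ 2 ∷ [])) (pp B 3 red) (pp B 3 blue)) (p3 (N 2) (N 0) (N 1) red) (node (N 0) (N 3) (done (2 ∷ 3 ∷ 0 ∷ []) (1 ∷ [])) (p3 (N 2) (N 0) (N 3) red) (p3 (N 1) (N 0) (N 3) blue))) (p3 (N 0) (N 2) (N 3) red) (node (N 0) (N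 3) (node (N 1) (N 2) (done (3 ∷ 0 ∷ []) (1 ∷ 2 ∷ [])) (p3 (N 0) (N 2) (N 1) red) (p3 (N 3) (N 2) (N 1) blue)) (p3 (N 2) (N 0) (N 3) red) (p3 (N 2) (N 3) (N 0) blue))) (node (N 2) (N 3) (node (N 0) (N 1) (node A (N 2) (done (3 ∷ 2 ∷ []) (1 ∷ 0 ∷ [])) (pp A 2 red) (p3 (N 0) (N 2) A blue)) (node (N 0) (N 3) (done (2 ∷ 3 ∷ 0 ∷ []) (1 ∷ [])) (p3 (N 1) (N 0) (N 3) red) (p3 (N 2) (N 0) (N 3) blue)) (p3 (N 2) (N 0) (N 1) blue)) (node (N 0) (N 3) (node (N 1) (N 2) (done (3 ∷ 0 ∷ []) (1 ∷ 2 ∷ [])) (p3 (N 3) (N 2) (N 1) red) (p3 (N 0) (N 2) (N 1) blue)) (p3 (N 2) (N 3) (N 0) red) (p3 (N 2) (N 0) (N 3) blue)) (p3 (N 0) (N 2) (N 3) blue))) (pp B 1 red) (pp B 1 blue)) (pp A 0 red) (node A (N 1) (node (N 0) (N 1) (node (N 0) (N 2) (node B (N 3) (done (2 ∷ 0 ∷ 1 ∷ []) (3 ∷ [])) (pp B 3 red) (pp B 3 blue)) (node B (N 2) (node (N 0) (N 3) (done (3 ∷ 0 ∷ 1 ∷ []) (2 ∷ [])) (p3 (N 2) (N 0) (N 3) red) (p3 A (N 0) (N 3) blue)) (pp B 2 red) (pp B 2 blue)) (p3 A (N 0) (N 2) blue)) (node B (N 2) (node (N 0) (N 2) (node (N 0)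 (N 3) (done (1 ∷ []) (2 ∷ 0 ∷ 3 ∷ [])) (p3 (N 1) (N 0) (N 3) red) (p3 A (N 0) (N 3) blue)) (p3 (N 1) (N 0) (N 2) red) (p3 A (N 0) (N 2) blue)) (pp B 2 red) (pp B 2 blue)) (p3 A (N 0) (N 1) blue)) (pp A 1 red) (p3 (N 0) A (N 1) blue)))
strategy (true , true , false , false) = (node A (N 0) (node B (N 1) (node (N 0) (N 2) (node (N 0) (N 1) (node A (N 3) (done (3 ∷ []) (1 ∷ 0 ∷ 2 ∷ [])) (pp A 3 red) (pp A 3 blue)) (node (N 0) (N 3) (node A (N 2) (done (3 ∷ 0 ∷ 2 ∷ []) (1 ∷ [])) (pp A 2 red) (pp A 2 blue)) (p3 (N 1) (N 0) (N 3) red) (node (N 1) (N 3) (done (2 ∷ 0 ∷ []) (1 ∷ 3 ∷ [])) (p3 (N 0) (N 1) (N 3) red) (p3 (N 0) (N 3) (N 1) blue))) (node (N 0) (N 3) (node A (N 2) (done (3 ∷ 0 ∷ 2 ∷ []) (1 ∷ [])) (pp A 2 red) (pp A 2 blue)) (node (N 1) (N 3) (done (2 ∷ 0 ∷ []) (1 ∷ 3 ∷ [])) (p3 (N 0) (N 3) (N 1) red) (p3 (N 0) (N 1) (N 3) blue)) (p3 (N 1) (N 0) (N 3) blue))) (node (N 2) (N 3) (node (N 0) (N 1) (node A (N 2) (done (3 ∷ 2 ∷ []) (1 ∷ 0 ∷ [])) (p3 (N 0) (N 2) A red) (pp A 2 blue)) (p3 (N 2) (N 0) (N 1) red) (node (N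 0) (N 3) (done (2 ∷ 3 ∷ 0 ∷ []) (1 ∷ [])) (p3 (N 2) (N 0) (N 3) red) (p3 (N 1) (N 0) (N 3) blue))) (p3 (N 0) (N 2) (N 3) red) (node (N 0) (N 3) (node (N 1) (N 2) (done (3 ∷ 0 ∷ []) (1 ∷ 2 ∷ [])) (p3 (N 0) (N 2) (N 1) red) (p3 (N 3) (N 2) (N 1) blue)) (p3 (N 2) (N 0) (N 3) red) (p3 (N 2) (N 3) (N 0) blue))) (node (N 2) (N 3) (node (N 0) (N 1) (node A (N 2) (done (3 ∷ 2 ∷ []) (1 ∷ 0 ∷ [])) (pp A 2 red) (p3 (N 0) (N 2) A blue)) (node (N 0) (N 3) (done (2 ∷ 3 ∷ 0 ∷ []) (1 ∷ [])) (p3 (N 1) (N 0) (N 3) red) (p3 (N 2) (N 0) (N 3) blue)) (p3 (N 2) (N 0) (N 1) blue)) (node (N 0) (N 3) (node (N 1) (N 2) (done (3 ∷ 0 ∷ []) (1 ∷ 2 ∷ [])) (p3 (N 3) (N 2) (N 1) red) (p3 (N 0) (N 2) (N 1) blue)) (p3 (N 2) (N 3) (N 0) red) (p3 (N 2) (N 0) (N 3) blue)) (p3 (N 0) (N 2) (N 3) blue))) (node (N 1) (N 2) (node B (N 3) (node (N 0) (N 1) (done (2 ∷ 1 ∷ 0 ∷ []) (3 ∷ [])) (p3 B (N 1) (N 0) red) (node (N 1) (N 3) (done (0 ∷ []) (3 ∷ 1 ∷ 2 ∷ [])) (p3 B (N 1) (N 3) red) (p3 (N 0) (N 1) (N 3)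 blue))) (p3 (N 1) B (N 3) red) (node B (N 2) (node (N 1) (N 3) (done (0 ∷ []) (2 ∷ 1 ∷ 3 ∷ [])) (p3 B (N 1) (N 3) red) (p3 B (N 3) (N 1) blue)) (p3 (N 1) B (N 2) red) (p3 (N 3) B (N 2) blue))) (p3 B (N 1) (N 2) red) (node B (N 2) (node (N 0) (N 1) (node (N 1) (N 3) (done (3 ∷ 1 ∷ 0 ∷ []) (2 ∷ [])) (p3 B (N 1) (N 3) red) (p3 (N 2) (N 1) (N 3) blue)) (p3 B (N 1) (N 0) red) (p3 (N 2) (N 1) (N 0) blue)) (p3 (N 1) B (N 2) red) (p3 (N 1) (N 2) B blue))) (node (N 1) (N 2) (node B (N 3) (node (N 0) (N 1) (done (2 ∷ 1 ∷ 0 ∷ []) (3 ∷ [])) (node (N 1) (N 3) (done (0 ∷ []) (3 ∷ 1 ∷ 2 ∷ [])) (p3 (N 0) (N 1) (N 3) red) (p3 B (N 1) (N 3) blue)) (p3 B (N 1) (N 0) blue)) (node B (N 2) (node (N 1) (N 3) (done (0 ∷ []) (2 ∷ 1 ∷ 3 ∷ [])) (p3 B (N 3) (N 1) red) (p3 B (N 1) (N 3) blue)) (p3 (N 3) B (N 2) red) (p3 (N 1) B (N 2) blue)) (p3 (N 1) B (N 3) blue)) (node B (N 2) (node (N 0) (N 1) (node (N 1) (N 3) (done (3 ∷ 1 ∷ 0 ∷ []) (2 ∷ [])) (p3 (N 2) (N 1) (N 3) red) (p3 B (N 1) (N 3) blue)) (p3 (N 2) (N 1) (N 0) red) (p3 B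 (N 1) (N 0) blue)) (p3 (N 1) (N 2) B red) (p3 (N 1) B (N 2) blue)) (p3 B (N 1) (N 2) blue))) (pp A 0 red) (pp A 0 blue))
strategy (true , true , false , true) = (node A (N 0) (node B (N 1) (node (N 0) (N 2) (node (N 0) (N 1) (node A (N 3) (done (3 ∷ []) (1 ∷ 0 ∷ 2 ∷ [])) (pp A 3 red) (pp A 3 blue)) (node (N 0) (N 3) (node A (N 2) (done (3 ∷ 0 ∷ 2 ∷ []) (1 ∷ [])) (pp A 2 red) (pp A 2 blue)) (p3 (N 1) (N 0) (N 3) red) (node (N 1) (N 3) (done (2 ∷ 0 ∷ []) (1 ∷ 3 ∷ [])) (p3 (N 0) (N 1) (N 3) red) (p3 (N 0) (N 3) (N 1) blue))) (node (N 0) (N 3) (node A (N 2) (done (3 ∷ 0 ∷ 2 ∷ []) (1 ∷ [])) (pp A 2 red) (pp A 2 blue)) (node (N 1) (N 3) (done (2 ∷ 0 ∷ []) (1 ∷ 3 ∷ [])) (p3 (N 0) (N 3) (N 1) red) (p3 (N 0) (N 1) (N 3) blue)) (p3 (N 1) (N 0) (N 3) blue))) (node (N 2) (N 3) (node (N 0) (N 1) (node A (N 2) (done (3 ∷ 2 ∷ []) (1 ∷ 0 ∷ [])) (pp A 2 red) (pp A 2 blue)) (p3 (N 2) (N 0) (N 1) red) (node (N 0) (N 3) (done (2 ∷ 3 ∷ 0 ∷ []) (1 ∷ [])) (p3 (N 2) (N 0) (N 3) red) (p3 (N 1) (N 0) (N 3) blue))) (p3 (N 0) (N 2) (N 3)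 red) (node (N 0) (N 3) (node (N 1) (N 2) (done (3 ∷ 0 ∷ []) (1 ∷ 2 ∷ [])) (p3 (N 0) (N 2) (N 1) red) (p3 (N 3) (N 2) (N 1) blue)) (p3 (N 2) (N 0) (N 3) red) (p3 (N 2) (N 3) (N 0) blue))) (node (N 2) (N 3) (node (N 0) (N 1) (node A (N 2) (done (3 ∷ 2 ∷ []) (1 ∷ 0 ∷ [])) (pp A 2 red) (pp A 2 blue)) (node (N 0) (N 3) (done (2 ∷ 3 ∷ 0 ∷ []) (1 ∷ [])) (p3 (N 1) (N 0) (N 3) red) (p3 (N 2) (N 0) (N 3) blue)) (p3 (N 2) (N 0) (N 1) blue)) (node (N 0) (N 3) (node (N 1) (N 2) (done (3 ∷ 0 ∷ []) (1 ∷ 2 ∷ [])) (p3 (N 3) (N 2) (N 1) red) (p3 (N 0) (N 2) (N 1) blue)) (p3 (N 2) (N 3) (N 0) red) (p3 (N 2) (N 0) (N 3) blue)) (p3 (N 0) (N 2) (N 3) blue))) (node (N 0) (N 1) (node (N 1) (N 2) (node B (N 3) (done (2 ∷ 1 ∷ 0 ∷ []) (3 ∷ [])) (p3 (N 1) B (N 3) red) (pp B 3 blue)) (p3 B (N 1) (N 2) red) (node B (N 2) (node (N 1) (N 3) (done (3 ∷ 1 ∷ 0 ∷ []) (2 ∷ [])) (p3 B (N 1) (N 3) red) (p3 (N 2) (N 1) (N 3) blue)) (p3 (N 1) B (N 2) red) (p3 (N 1) (N 2) B blue))) (p3 B (N 1) (N 0) red) (node B (N 2) (node (N 1) (N 2)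 (node (N 1) (N 3) (done (0 ∷ []) (2 ∷ 1 ∷ 3 ∷ [])) (p3 B (N 1) (N 3) red) (p3 (N 0) (N 1) (N 3) blue)) (p3 B (N 1) (N 2) red) (p3 (N 0) (N 1) (N 2) blue)) (p3 (N 1) B (N 2) red) (pp B 2 blue))) (pp B 1 blue)) (pp A 0 red) (pp A 0 blue))
strategy (true , true , true , false) = (node A (N 0) (node B (N 1) (node (N 0) (N 2) (node (N 0) (N 1) (node A (N 3) (done (3 ∷ []) (1 ∷ 0 ∷ 2 ∷ [])) (pp A 3 red) (pp A 3 blue)) (node (N 0) (N 3) (node A (N 2) (done (3 ∷ 0 ∷ 2 ∷ []) (1 ∷ [])) (pp A 2 red) (pp A 2 blue)) (p3 (N 1) (N 0) (N 3) red) (node (N 1) (N 3) (done (2 ∷ 0 ∷ []) (1 ∷ 3 ∷ [])) (p3 (N 0) (N 1) (N 3) red) (p3 (N 0) (N 3) (N 1) blue))) (node (N 0) (N 3) (node A (N 2) (done (3 ∷ 0 ∷ 2 ∷ []) (1 ∷ [])) (pp A 2 red) (pp A 2 blue)) (node (N 1) (N 3) (done (2 ∷ 0 ∷ []) (1 ∷ 3 ∷ [])) (p3 (N 0) (N 3) (N 1) red) (p3 (N 0) (N 1) (N 3) blue)) (p3 (N 1) (N 0) (N 3) blue))) (node (N 2) (N 3) (node (N 0) (N 1) (node A (N 2) (done (3 ∷ 2 ∷ []) (1 ∷ 0 ∷ [])) (p3 (N 0) (N 2) A red) (pp A 2 blue)) (p3 (N 2) (N 0) (N 1) red) (node (N 0)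 (N 3) (done (2 ∷ 3 ∷ 0 ∷ []) (1 ∷ [])) (p3 (N 2) (N 0) (N 3) red) (p3 (N 1) (N 0) (N 3) blue))) (p3 (N 0) (N 2) (N 3) red) (node (N 0) (N 3) (node (N 1) (N 2) (done (3 ∷ 0 ∷ []) (1 ∷ 2 ∷ [])) (p3 (N 0) (N 2) (N 1) red) (p3 (N 3) (N 2) (N 1) blue)) (p3 (N 2) (N 0) (N 3) red) (p3 (N 2) (N 3) (N 0) blue))) (node (N 2) (N 3) (node (N 0) (N 1) (node A (N 2) (done (3 ∷ 2 ∷ []) (1 ∷ 0 ∷ [])) (pp A 2 red) (p3 (N 0) (N 2) A blue)) (node (N 0) (N 3) (done (2 ∷ 3 ∷ 0 ∷ []) (1 ∷ [])) (p3 (N 1) (N 0) (N 3) red) (p3 (N 2) (N 0) (N 3) blue)) (p3 (N 2) (N 0) (N 1) blue)) (node (N 0) (N 3) (node (N 1) (N 2) (done (3 ∷ 0 ∷ []) (1 ∷ 2 ∷ [])) (p3 (N 3) (N 2) (N 1) red) (p3 (N 0) (N 2) (N 1) blue)) (p3 (N 2) (N 3) (N 0) red) (p3 (N 2) (N 0) (N 3) blue)) (p3 (N 0) (N 2) (N 3) blue))) (pp B 1 red) (node (N 0) (N 1) (node (N 1) (N 2) (node B (N 3) (done (2 ∷ 1 ∷ 0 ∷ []) (3 ∷ [])) (pp B 3 red) (p3 (N 1) B (N 3) blue)) (node B (N 2) (node (N 1) (N 3) (done (3 ∷ 1 ∷ 0 ∷ []) (2 ∷ [])) (p3 (N 2)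 (N 1) (N 3) red) (p3 B (N 1) (N 3) blue)) (p3 (N 1) (N 2) B red) (p3 (N 1) B (N 2) blue)) (p3 B (N 1) (N 2) blue)) (node B (N 2) (node (N 1) (N 2) (node (N 1) (N 3) (done (0 ∷ []) (2 ∷ 1 ∷ 3 ∷ [])) (p3 (N 0) (N 1) (N 3) red) (p3 B (N 1) (N 3) blue)) (p3 (N 0) (N 1) (N 2) red) (p3 B (N 1) (N 2) blue)) (pp B 2 red) (p3 (N 1) B (N 2) blue)) (p3 B (N 1) (N 0) blue))) (pp A 0 red) (pp A 0 blue))
strategy (true , true , true , true) = (node A (N 0) (node B (N 1) (node (N 0) (N 2) (node (N 0) (N 1) (node A (N 3) (done (3 ∷ []) (1 ∷ 0 ∷ 2 ∷ [])) (pp A 3 red) (pp A 3 blue)) (node (N 0) (N 3) (node A (N 2) (done (3 ∷ 0 ∷ 2 ∷ []) (1 ∷ [])) (pp A 2 red) (pp A 2 blue)) (p3 (N 1) (N 0) (N 3) red) (node (N 1) (N 3) (done (2 ∷ 0 ∷ []) (1 ∷ 3 ∷ [])) (p3 (N 0) (N 1) (N 3) red) (p3 (N 0) (N 3) (N 1) blue))) (node (N 0) (N 3) (node A (N 2) (done (3 ∷ 0 ∷ 2 ∷ []) (1 ∷ [])) (pp A 2 red) (pp A 2 blue)) (node (N 1) (N 3) (done (2 ∷ 0 ∷ []) (1 ∷ 3 ∷ [])) (p3 (N 0) (N 3) (N 1) red) (p3 (N 0) (N 1) (N 3) blue)) (p3 (N 1) (N 0) (N 3) blue))) (node (N 2)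 (N 3) (node (N 0) (N 1) (node A (N 2) (done (3 ∷ 2 ∷ []) (1 ∷ 0 ∷ [])) (p3 (N 0) (N 2) A red) (pp A 2 blue)) (p3 (N 2) (N 0) (N 1) red) (node (N 0) (N 3) (done (2 ∷ 3 ∷ 0 ∷ []) (1 ∷ [])) (p3 (N 2) (N 0) (N 3) red) (p3 (N 1) (N 0) (N 3) blue))) (p3 (N 0) (N 2) (N 3) red) (node (N 0) (N 3) (node (N 1) (N 2) (done (3 ∷ 0 ∷ []) (1 ∷ 2 ∷ [])) (p3 (N 0) (N 2) (N 1) red) (p3 (N 3) (N 2) (N 1) blue)) (p3 (N 2) (N 0) (N 3) red) (p3 (N 2) (N 3) (N 0) blue))) (node (N 2) (N 3) (node (N 0) (N 1) (node A (N 2) (done (3 ∷ 2 ∷ []) (1 ∷ 0 ∷ [])) (pp A 2 red) (p3 (N 0) (N 2) A blue)) (node (N 0) (N 3) (done (2 ∷ 3 ∷ 0 ∷ []) (1 ∷ [])) (p3 (N 1) (N 0) (N 3) red) (p3 (N 2) (N 0) (N 3) blue)) (p3 (N 2) (N 0) (N 1) blue)) (node (N 0) (N 3) (node (N 1) (N 2) (done (3 ∷ 0 ∷ []) (1 ∷ 2 ∷ [])) (p3 (N 3) (N 2) (N 1) red) (p3 (N 0) (N 2) (N 1) blue)) (p3 (N 2) (N 3) (N 0) red) (p3 (N 2) (N 0) (N 3) blue)) (p3 (N 0) (N 2) (N 3) blue))) (pp B 1 red) (pp B 1 blue)) (pp A 0 red) (pp A 0 blue))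

winning : ∀ s → Winning s (strategy s)
winning s@(false , false , false , false) = byDecision s (strategy s)
winning s@(false , false , false , true) = byDecision s (strategy s)
winning s@(false , false , true , false) = byDecision s (strategy s)
winning s@(false , false , true , true) = byDecision s (strategy s)
winning s@(false , true , false , false) = byDecision s (strategy s)
winning s@(false , true , false , true) = byDecision s (strategy s)
winning s@(false , true , true , false) = byDecision s (strategy s)
winning s@(false , true , true , true) = byDecision s (strategy s)
winning s@(true , false , false , false) = byDecision s (strategy s)
winning s@(true , false , false , true) = byDecision s (strategy s)
winning s@(true , false , true , false) = byDecision s (strategy s)
winning s@(true , false , true , true) = byDecision s (strategy s)
winning s@(true , true , false , false) = byDecision s (strategy s)
winning s@(true , true , false , true) = byDecision s (strategy s)
winning s@(true , true , true , false) = byDecision s (strategy s)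
winning s@(true , true , true , true) = byDecision s (strategy s)

-- Phases

record Phase : Set where
  constructor phase
  field
    a b fresh : ℕ
    path : List ℕ
    status : Status
open Phase

⟦_⟧ : Phase → Loc → ℕ
⟦ p ⟧ A = a p
⟦ p ⟧ B = b p
⟦ p ⟧ (N i) = fresh p + i

record PhaseInvariant (H : Board) (p : Phase) : Set where
  field
    path-linked : Linked (EdgeCol H green) (path p)
    path-unique : Unique (path p)
    path-head : ∃ λ r → path p ≡ a p ∷ r
    path-last : ∃ λ i → path p ≡ i ∷ʳ b p
    a≢b : a p ≢ b p
    path-below : All (_< fresh p) (path p)
    board-below : Below (fresh p) H
    loopless : All NoLoop H
    status-reflects : ∀ e c → IsEnd e → NonGreen c →
                      Reflects (Touches H c (⟦ p ⟧ e)) (statusAt (status p) e c)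

clean-bonus : ∀ s → statusAt s A red ≡ false → statusAt s A blue ≡ false →
              statusAt s B red ≡ false → statusAt s B blue ≡ false → bonus s ≡ 1
clean-bonus (false , false , false , false) _ _ _ _ = refl
clean-bonus (true , _ , _ , _) () _ _ _
clean-bonus (false , true , _ , _) _ () _ _
clean-bonus (false , false , true , _) _ _ () _
clean-bonus (false , false , false , true) _ _ _ ()

module PhaseFacts {H : Board} {p : Phase} (I : PhaseInvariant H p) where
  open PhaseInvariant I

  a<fresh : a p < fresh p
  a<fresh with _ , eq ← path-head = All.head (subst (All (_< fresh p)) eq path-below)

  b<fresh : b p < fresh p
  b<fresh with i , eq ← path-last = All.head (AllP.++⁻ʳ i (subst (All (_< fresh p)) eq path-below))

  fresh≰ : ∀ {x} i → x < fresh p → x ≢ fresh p + i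
  fresh≰ i x<f x≡ = <⇒≱ x<f (subst (fresh p ≤_) (sym x≡) (m≤m+n (fresh p) i))

  ⟦⟧-injective : ∀ {x y} → ⟦ p ⟧ x ≡ ⟦ p ⟧ y → x ≡ y
  ⟦⟧-injective {A} {A} _ = refl
  ⟦⟧-injective {A} {B} eq = ⊥-elim (a≢b eq)
  ⟦⟧-injective {A} {N i} eq = ⊥-elim (fresh≰ i a<fresh eq)
  ⟦⟧-injective {B} {A} eq = ⊥-elim (a≢b (sym eq))
  ⟦⟧-injective {B} {B} _ = refl
  ⟦⟧-injective {B} {N i} eq = ⊥-elim (fresh≰ i b<fresh eq)
  ⟦⟧-injective {N i} {A} eq = ⊥-elim (fresh≰ i a<fresh (sym eq))
  ⟦⟧-injective {N i} {B} eq = ⊥-elim (fresh≰ i b<fresh (sym eq))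
  ⟦⟧-injective {N i} {N j} eq = cong N (+-cancelˡ-≡ (fresh p) i j eq)

  end<fresh : ∀ e → IsEnd e → ⟦ p ⟧ e < fresh p
  end<fresh A _ = a<fresh
  end<fresh B _ = b<fresh

  inWindow-below : ∀ x → InWindow x → ⟦ p ⟧ x < fresh p + phaseWidth
  inWindow-below A _ = <-≤-trans a<fresh (m≤m+n (fresh p) phaseWidth)
  inWindow-below B _ = <-≤-trans b<fresh (m≤m+n (fresh p) phaseWidth)
  inWindow-below (N i) i<w = +-monoʳ-< (fresh p) i<w

  status-reflects′ : ∀ e c → NonGreen c → Reflects (Touches H c (⟦ p ⟧ e)) (statusAt (status p) e c)
  status-reflects′ A c = status-reflects A c tt
  status-reflects′ B c = status-reflects B c tt
  status-reflects′ (N i) c _ = ofⁿ λ (_ , e) → fresh≰ i (proj₁ (Edge-below board-below e)) refl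

  path-walk : Walk H green (path p)
  path-walk with r , eq ← path-head =
    subst (Walk H green) (sym eq) (Linked⇒Walk (subst (Linked (EdgeCol H green)) eq path-linked))

  monoPath : ∀ {m} → length (path p) ≡ m → MonoPath H green m (path p)
  monoPath length≡ = path-walk , path-unique , length≡

  good-or-bad : GoodPath H (path p) ⊎ (BadPath H (path p) × bonus (status p) ≡ 1)
  good-or-bad with incident? H (a p) | incident? H (b p)
  ... | yes a-incident | _ = inj₁ (a p , inj₁ path-head , a-incident)
  ... | no _ | yes b-incident = inj₁ (b p , inj₂ path-last , b-incident)
  ... | no a-clean | no b-clean = inj₂ (clean-ends , clean-bonus (status p)
        (untouched A red λ (w , e) → a-clean (w , inj₁ e)) (untouched A blue λ (w , e) → a-clean (w , inj₂ e))
        (untouched B red λ (w , e) → b-clean (w , inj₁ e)) (untouched B blue λ (w , e) → b-clean (w , inj₂ e)))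
    where
      untouched : ∀ e c {ng : NonGreen c} → ¬ Touches H c (⟦ p ⟧ e) → statusAt (status p) e c ≡ false
      untouched e c {ng} = Reflects-false (status-reflects′ e c ng)
      clean-ends : BadPath H (path p)
      clean-ends x (inj₁ (_ , eq)) =
        subst (λ y → ¬ IncidentNonGreen H y) (sym (∷-injectiveˡ (trans (sym eq) (proj₂ path-head)))) a-clean
      clean-ends x (inj₂ (i , eq)) =
        subst (λ y → ¬ IncidentNonGreen H y) (sym (∷ʳ-injectiveʳ i _ (trans (sym eq) (proj₂ path-last)))) b-clean

data WellFormedMove : Loc × Loc × Colour → Set where
  wellFormed : ∀ {u v c} → InWindow u → InWindow v → u ≢ v → WellFormedMove (u , v , c)

wellFormed-∷ʳ : ∀ {L u v c} → All WellFormedMove L → LegalLocal L u v → All WellFormedMove (L ∷ʳ (u , v , c))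
wellFormed-∷ʳ wf (u-in , v-in , u≢v , _) = AllP.∷ʳ⁺ wf (wellFormed u-in v-in u≢v)

extend : Phase → LMoves → List ℕ → List ℕ → Phase
extend p L X Y = phase (⟦ p ⟧ (endA X)) (⟦ p ⟧ (endB Y)) (fresh p + phaseWidth)
                       (map (fresh p +_) X ++ path p ++ map (fresh p +_) Y) (newStatus (status p) L X Y)

module AfterLocalMoves {H : Board} {p : Phase} (I : PhaseInvariant H p) (L : LMoves) where
  open PhaseInvariant I
  open PhaseFacts I

  H′ : Board
  H′ = H ++ mapMoves ⟦ p ⟧ L

  old-edge : ∀ {c x y} → EdgeCol H c x y → EdgeCol H′ c x y
  old-edge = Edge-++⁺ˡ {h′ = mapMoves ⟦ p ⟧ L}

  local-edge : ∀ {c u v} → Edge L c u v → EdgeCol H′ c (⟦ p ⟧ u) (⟦ p ⟧ v)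
  local-edge e = Edge-++⁺ʳ (Edge-map⁺ ⟦ p ⟧ e)

  legal : ∀ {u v} → LegalLocal L u v → Legal H′ (⟦ p ⟧ u , ⟦ p ⟧ v)
  legal {u} {v} (_ , _ , u≢v , new , ¬adj) = u≢v ∘′ ⟦⟧-injective , not-adjacent
    where
      new-is-fresh : ∀ {x} → IsNew x → fresh p ≤ ⟦ p ⟧ x
      new-is-fresh {N i} _ = m≤m+n (fresh p) i
      not-adjacent : ¬ Adjacent H′ (⟦ p ⟧ u) (⟦ p ⟧ v)
      not-adjacent (c , e) with Edge-++⁻ e
      ... | inj₂ e′ = ¬adj (c , Edge-map⁻ ⟦ p ⟧ ⟦⟧-injective e′)
      ... | inj₁ e′ = [ <⇒≱ u< ∘′ new-is-fresh , <⇒≱ v< ∘′ new-is-fresh ]′ new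
        where u< = proj₁ (Edge-below board-below e′)
              v< = proj₂ (Edge-below board-below e′)

  p3-sound : ∀ {s x y z c} → Certified s L (p3 x y z c) → HasMonoP H′ c 3
  p3-sound (_ , e₁ , e₂ , x≢y , x≢z , y≢z , _) =
    monoP₃ (local-edge e₁) (local-edge e₂)
           (x≢y ∘′ ⟦⟧-injective) (x≢z ∘′ ⟦⟧-injective) (y≢z ∘′ ⟦⟧-injective)

  -- The P₃ is w e (N i), where w is the old c-neighbour of the endpoint e.
  pp-sound : ∀ {e i c} → Certified (status p) L (pp e i c) → HasMonoP H′ c 3
  pp-sound {e} {i} {c} (ng , end , touched , e₂ , _)
    with w , e₁ ← Reflects-witness (status-reflects e c end ng) touched =
    monoP₃ (old-edge (Edge-sym e₁)) (local-edge e₂) (Edge-loopless loopless e₁ ∘′ sym)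
           (fresh≰ i (proj₂ (Edge-below board-below e₁))) (fresh≰ i (end<fresh e end))

  touchedAfter-reflects : ∀ e c → NonGreen c →
                          Reflects (Touches H′ c (⟦ p ⟧ e)) (touchedAfter (status p) L e c)
  touchedAfter-reflects e c ng =
    Reflects-map Touches-++⁺ Touches-++⁻ (status-reflects′ e c ng ⊎-reflects local-reflects)
    where
      local-reflects : Reflects (Touches (mapMoves ⟦ p ⟧ L) c (⟦ p ⟧ e)) (does (touchesᴸ? L c e))
      local-reflects =
        Reflects-map (Touches-map⁺ ⟦ p ⟧) (Touches-map⁻ ⟦ p ⟧ ⟦⟧-injective) (proof (touchesᴸ? L c e))

  new-≥fresh : ∀ {z} zs → z ∈ map (fresh p +_) zs → fresh p ≤ z
  new-≥fresh zs z∈ with _ , _ , refl ← ∈-map⁻ (fresh p +_) z∈ = m≤m+n (fresh p) _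

  new-below : ∀ {zs} → All (_< phaseWidth) zs → All (_< fresh p + phaseWidth) (map (fresh p +_) zs)
  new-below = AllP.map⁺ ∘′ All.map (+-monoʳ-< (fresh p))

  extend-head : ∀ X ys → ∃ λ r → map (fresh p +_) X ++ path p ++ ys ≡ ⟦ p ⟧ (endA X) ∷ r
  extend-head [] ys with r , eq ← path-head = r ++ ys , cong (_++ ys) eq
  extend-head (_ ∷ _) _ = _ , refl

  extend-last : ∀ xs Y → ∃ λ i → xs ++ path p ++ map (fresh p +_) Y ≡ i ∷ʳ ⟦ p ⟧ (endB Y)
  extend-last xs Y with initLast Y
  ... | [] with i , eq ← path-last = xs ++ i , (begin
      xs ++ path p ++ []     ≡⟨ cong (xs ++_) (++-identityʳ (path p)) ⟩
      xs ++ path p           ≡⟨ cong (xs ++_) eq ⟩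
      xs ++ i ∷ʳ b p         ≡⟨ ++-assoc xs i _ ⟨
      (xs ++ i) ∷ʳ b p       ∎)
    where open ≡-Reasoning
  ... | ys ∷ʳ′ j = xs ++ path p ++ map (fresh p +_) ys , (begin
      xs ++ path p ++ map (fresh p +_) (ys ∷ʳ j)           ≡⟨ cong (λ zs → xs ++ path p ++ zs) (map-++ _ ys _) ⟩
      xs ++ path p ++ map (fresh p +_) ys ∷ʳ (fresh p + j)  ≡⟨ cong (xs ++_) (++-assoc (path p) _ _) ⟨
      xs ++ (path p ++ map (fresh p +_) ys) ∷ʳ (fresh p + j) ≡⟨ ++-assoc xs _ _ ⟨
      (xs ++ path p ++ map (fresh p +_) ys) ∷ʳ (fresh p + j) ≡⟨ cong (λ e → _ ∷ʳ ⟦ p ⟧ e) (endB-∷ʳ ys j) ⟨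
      (xs ++ path p ++ map (fresh p +_) ys) ∷ʳ ⟦ p ⟧ (endB (ys ∷ʳ j)) ∎)
    where open ≡-Reasoning

  module _ (wf : All WellFormedMove L) where
    H′-below : Below (fresh p + phaseWidth) H′
    H′-below = AllP.++⁺ (All.map weaken board-below) local-below
      where
        weaken : ∀ {m} → EdgeBelow (fresh p) m → EdgeBelow (fresh p + phaseWidth) m
        weaken (below u< v<) = below (<-≤-trans u< (m≤m+n _ _)) (<-≤-trans v< (m≤m+n _ _))
        interpreted-below : ∀ {m} → WellFormedMove m → EdgeBelow (fresh p + phaseWidth) (mapMove ⟦ p ⟧ m)
        interpreted-below (wellFormed {u} {v} u-in v-in _) = below (inWindow-below u u-in) (inWindow-below v v-in)
        local-below : Below (fresh p + phaseWidth) (mapMoves ⟦ p ⟧ L)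
        local-below = AllP.map⁺ (All.map interpreted-below wf)

    H′-loopless : All NoLoop H′
    H′-loopless = AllP.++⁺ loopless local-loopless
      where
        interpreted-loopless : ∀ {m} → WellFormedMove m → NoLoop (mapMove ⟦ p ⟧ m)
        interpreted-loopless (wellFormed _ _ u≢v) = noLoop (u≢v ∘′ ⟦⟧-injective)
        local-loopless : All NoLoop (mapMoves ⟦ p ⟧ L)
        local-loopless = AllP.map⁺ (All.map interpreted-loopless wf)

    module Completed {X Y} (length≡4 : length X + length Y ≡ 4)
                     (XY-unique : Unique (X ++ Y)) (XY-window : All (_< phaseWidth) (X ++ Y))
                     (X-linked : Linked (Edge L green) (map N X ∷ʳ A))
                     (Y-linked : Linked (Edge L green) (B ∷ map N Y)) where
      GreenLinked′ : List ℕ → Set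
      GreenLinked′ = Linked (EdgeCol H′ green)

      newX newY : List ℕ
      newX = map (fresh p +_) X
      newY = map (fresh p +_) Y

      interpret-linked : ∀ {xs} → Linked (Edge L green) xs → GreenLinked′ (map ⟦ p ⟧ xs)
      interpret-linked = LinkedP.map⁺ ∘′ Linked.map local-edge

      newX-linked : GreenLinked′ (newX ∷ʳ a p)
      newX-linked = subst GreenLinked′ (trans (map-++ ⟦ p ⟧ (map N X) _) (cong (_∷ʳ a p) (sym (map-∘ X))))
                          (interpret-linked X-linked)

      newY-linked : GreenLinked′ (b p ∷ newY)
      newY-linked = subst (λ ys → GreenLinked′ (b p ∷ ys)) (sym (map-∘ Y)) (interpret-linked Y-linked)

      path++newY-linked : GreenLinked′ (path p ++ newY)
      path++newY-linked with i , eq ← path-last =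
        subst (λ q → GreenLinked′ (q ++ newY)) (sym eq) (subst GreenLinked′ (sym (++-assoc i _ newY))
          (Linked-++-shared i (subst GreenLinked′ eq (Linked.map old-edge path-linked)) newY-linked))

      path′-linked : GreenLinked′ (newX ++ path p ++ newY)
      path′-linked with r , eq ← path-head =
        subst (λ q → GreenLinked′ (newX ++ q ++ newY)) (sym eq)
          (Linked-++-shared newX newX-linked (subst (λ q → GreenLinked′ (q ++ newY)) eq path++newY-linked))

      path′-unique : Unique (newX ++ path p ++ newY)
      path′-unique = Unique-++-middle newX new-unique path-unique old∉new
        where
          new-unique : Unique (newX ++ newY)
          new-unique = subst Unique (map-++ _ X Y) (Unique.map⁺ (+-cancelˡ-≡ (fresh p) _ _) XY-unique)
          old∉new : Disjoint (path p) (newX ++ newY)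
          old∉new (z∈path , z∈new) =
            <⇒≱ (All.lookup path-below z∈path) (new-≥fresh (X ++ Y) (subst (_ ∈_) (sym (map-++ _ X Y)) z∈new))

      path′-length : length (newX ++ path p ++ newY) ≡ length (path p) + 4
      path′-length = begin
        length (newX ++ path p ++ newY)               ≡⟨ length-++ newX ⟩
        length newX + length (path p ++ newY)         ≡⟨ cong₂ _+_ (length-map _ X) (length-++ (path p)) ⟩
        length X + (length (path p) + length newY)    ≡⟨ cong (λ ℓ → length X + (length (path p) + ℓ)) (length-map _ Y) ⟩
        length X + (length (path p) + length Y)       ≡⟨ x∙yz≈y∙xz (length X) (length (path p)) (length Y) ⟩
        length (path p) + (length X + length Y)       ≡⟨ cong (length (path p) +_) length≡4 ⟩
        length (path p) + 4                           ∎
        where open ≡-Reasoning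

      path′-below : All (_< fresh p + phaseWidth) (newX ++ path p ++ newY)
      path′-below = AllP.++⁺ (new-below (AllP.++⁻ˡ X XY-window))
                      (AllP.++⁺ (All.map (λ x< → <-≤-trans x< (m≤m+n _ _)) path-below)
                                (new-below (AllP.++⁻ʳ X XY-window)))

      invariant : PhaseInvariant H′ (extend p L X Y)
      invariant = record
        { path-linked = path′-linked
        ; path-unique = path′-unique
        ; path-head = extend-head X newY
        ; path-last = extend-last newX Y
        ; a≢b = head≢last path′-unique (proj₂ (extend-head X newY)) (proj₂ (extend-last newX Y))
                  (subst (2 ≤_) (sym path′-length) (≤-trans (s≤s (s≤s z≤n)) (m≤n+m 4 _)))
        ; path-below = path′-below
        ; board-below = H′-below
        ; loopless = H′-loopless
        ; status-reflects = λ where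
            A red _ _ → touchedAfter-reflects (endA X) red tt
            A blue _ _ → touchedAfter-reflects (endA X) blue tt
            B red _ _ → touchedAfter-reflects (endB Y) red tt
            B blue _ _ → touchedAfter-reflects (endB Y) blue tt
        }

-- Builder's strategy

statusOn : Board → ℕ → ℕ → Status
statusOn h x y = does (touches? h red x) , does (touches? h blue x) , does (touches? h red y) , does (touches? h blue y)

initialPhase : Board → ℕ → ℕ → ℕ → Phase
initialPhase h x y f = phase x y f (x ∷ y ∷ []) (statusOn h x y)

initial-invariant : ∀ {h x y f} → (x , y , green) ∈ h → x ≢ y → x < f → y < f → Below f h × All NoLoop h →
                    PhaseInvariant h (initialPhase h x y f)
initial-invariant {h} {x} {y} xy∈h x≢y x<f y<f (h-below , h-loopless) = record
  { path-linked = inj₁ xy∈h ∷ [-]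
  ; path-unique = (x≢y ∷ []) ∷ [] ∷ []
  ; path-head = _ , refl
  ; path-last = x ∷ [] , refl
  ; a≢b = x≢y
  ; path-below = x<f ∷ y<f ∷ []
  ; board-below = h-below
  ; loopless = h-loopless
  ; status-reflects = λ where
      A red _ _ → proof (touches? h red x)
      A blue _ _ → proof (touches? h blue x)
      B red _ _ → proof (touches? h red y)
      B blue _ _ → proof (touches? h blue y)
  }

data Mode : Set where
  opening : Mode
  oneEdge : Colour → Mode
  twoEdges : Colour → Colour → Mode
  inPhase : Phase → LMoves → Tree → Mode
  idle : ℕ → Mode

startPhase : Phase → Mode
startPhase p = inPhase p [] (strategy (status p))

next : Phase → LMoves → Tree → Mode
next p L t@(node _ _ _ _ _) = inPhase p L t
next p L (p3 _ _ _ _) = idle (fresh p + phaseWidth)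
next p L (pp _ _ _) = idle (fresh p + phaseWidth)
next p L (done X Y) = startPhase (extend p L X Y)

-- A phase only ever sits at a node of its tree, so the other inPhase cases are junk.
move : Mode → ℕ × ℕ
move opening = 0 , 1
move (oneEdge _) = 1 , 2
move (twoEdges _ _) = 1 , 3
move (inPhase p _ (node u v _ _ _)) = ⟦ p ⟧ u , ⟦ p ⟧ v
move (inPhase _ _ _) = 0 , 1
move (idle f) = f , suc f

update : Mode → Colour → Mode
update opening green = startPhase (initialPhase ((0 , 1 , green) ∷ []) 0 1 2)
update opening c = oneEdge c
update (oneEdge c) green = startPhase (initialPhase ((0 , 1 , c) ∷ (1 , 2 , green) ∷ []) 1 2 3)
update (oneEdge c) d = twoEdges c d
update (twoEdges c d) green = startPhase (initialPhase ((0 , 1 , c) ∷ (1 , 2 , d) ∷ (1 , 3 , green) ∷ []) 1 3 4)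
update (twoEdges _ _) _ = idle 4
update (inPhase p L (node u v tg _ _)) green = next p (L ∷ʳ (u , v , green)) tg
update (inPhase p L (node u v _ tr _)) red = next p (L ∷ʳ (u , v , red)) tr
update (inPhase p L (node u v _ _ tb)) blue = next p (L ∷ʳ (u , v , blue)) tb
update (inPhase _ _ _) _ = idle 0
update (idle f) _ = idle (suc (suc f))

advance : Mode → Move → Mode
advance ms (_ , _ , c) = update ms c

mode : Board → Mode
mode = foldl advance opening

builder : BuilderStrategy
builder h = move (mode h)

Consistent : Board → Mode → Set
Consistent h opening = h ≡ []
Consistent h (oneEdge c) = h ≡ (0 , 1 , c) ∷ []
Consistent h (twoEdges c d) = h ≡ (0 , 1 , c) ∷ (1 , 2 , d) ∷ []
Consistent h (inPhase p L t) =
  ∃ λ H → h ≡ H ++ mapMoves ⟦ p ⟧ L × PhaseInvariant H p × All WellFormedMove L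
          × IsNode t × Certified (status p) L t
Consistent h (idle f) = Below f h

legal-above : ∀ {h u v} → Below v h → u < v → Legal h (u , v)
legal-above h-below u<v = <⇒≢ u<v , λ (_ , e) → <-irrefl refl (proj₂ (Edge-below h-below e))

legal : ∀ h ms → Consistent h ms → Legal h (move ms)
legal _ opening refl = legal-above [] z<s
legal _ (oneEdge c) refl = legal-above (proj₁ (decideBoard 2 _)) (s<s z<s)
legal _ (twoEdges c d) refl = legal-above (proj₁ (decideBoard 3 _)) (s<s z<s)
legal _ (inPhase p L (node u v _ _ _)) (H , refl , I , _ , _ , ok , _) = AfterLocalMoves.legal I L ok
legal _ (idle f) f-below = legal-above (All.map weaken f-below) ≤-refl
  where
    weaken : ∀ {m} → EdgeBelow f m → EdgeBelow (suc f) m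
    weaken (below u< v<) = below (m<n⇒m<1+n u<) (m<n⇒m<1+n v<)

next-node : ∀ {p L t} → IsNode t → next p L t ≡ inPhase p L t
next-node node = refl

start-consistent : ∀ {h p} → PhaseInvariant h p → Consistent h (startPhase p)
start-consistent {h} {p} I = h , sym (++-identityʳ h) , I , [] , winning (status p)

next-consistent : ∀ {H p} L t → PhaseInvariant H p → All WellFormedMove L → Certified (status p) L t →
                  Consistent (H ++ mapMoves ⟦ p ⟧ L) (next p L t)
next-consistent L (node _ _ _ _ _) I wf ok = _ , refl , I , wf , node , ok
next-consistent L (p3 _ _ _ _) I wf _ = AfterLocalMoves.H′-below I L wf
next-consistent L (pp _ _ _) I wf _ = AfterLocalMoves.H′-below I L wf
next-consistent L (done X Y) I wf (length≡4 , unique , window , X-linked , Y-linked , _) =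
  start-consistent (AfterLocalMoves.Completed.invariant I L wf length≡4 unique window X-linked Y-linked)

after-local-move : ∀ {H p L u v c t} → PhaseInvariant H p → All WellFormedMove L → LegalLocal L u v →
                   Certified (status p) (L ∷ʳ (u , v , c)) t →
                   Consistent ((H ++ mapMoves ⟦ p ⟧ L) ∷ʳ (⟦ p ⟧ u , ⟦ p ⟧ v , c)) (next p (L ∷ʳ (u , v , c)) t)
after-local-move {H} {p} {L} {u} {v} {c} {t} I wf legal ok rewrite ++-mapMoves-∷ʳ ⟦ p ⟧ H L (u , v , c) =
  next-consistent (L ∷ʳ (u , v , c)) t I (wellFormed-∷ʳ wf legal) ok

update-consistent : ∀ h ms c → Consistent h ms →
                    Consistent (h ∷ʳ (proj₁ (move ms) , proj₂ (move ms) , c)) (update ms c)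
update-consistent _ opening green refl =
  start-consistent (initial-invariant (here refl) (λ ()) z<s (s<s z<s) (decideBoard 2 _))
update-consistent _ opening red refl = refl
update-consistent _ opening blue refl = refl
update-consistent _ (oneEdge c) green refl =
  start-consistent (initial-invariant (there (here refl)) (λ ()) (s<s z<s) (s<s (s<s z<s)) (decideBoard 3 _))
update-consistent _ (oneEdge c) red refl = refl
update-consistent _ (oneEdge c) blue refl = refl
update-consistent _ (twoEdges c d) green refl =
  start-consistent (initial-invariant (there (there (here refl))) (λ ()) (s<s z<s) (s<s (s<s (s<s z<s))) (decideBoard 4 _))
update-consistent _ (twoEdges c d) red refl = proj₁ (decideBoard 4 _)
update-consistent _ (twoEdges c d) blue refl = proj₁ (decideBoard 4 _)
update-consistent _ (inPhase p L (node u v _ _ _)) green (_ , refl , I , wf , _ , ok , okg , _) =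
  after-local-move I wf ok okg
update-consistent _ (inPhase p L (node u v _ _ _)) red (_ , refl , I , wf , _ , ok , _ , okr , _) =
  after-local-move I wf ok okr
update-consistent _ (inPhase p L (node u v _ _ _)) blue (_ , refl , I , wf , _ , ok , _ , _ , okb) =
  after-local-move I wf ok okb
update-consistent h (idle f) c f-below = AllP.∷ʳ⁺ (All.map weaken f-below) (below (m<n⇒m<1+n ≤-refl) ≤-refl)
  where
    weaken : ∀ {m} → EdgeBelow f m → EdgeBelow (suc (suc f)) m
    weaken (below u< v<) = below (m<n⇒m<1+n (m<n⇒m<1+n u<)) (m<n⇒m<1+n (m<n⇒m<1+n v<))

play-suc : ∀ S P n → let h = play S P n in play S P (suc n) ≡ h ∷ʳ (proj₁ (S h) , proj₂ (S h) , P h (S h))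
play-suc S P n with play S P n
... | h with S h
...   | _ = refl

mode-∷ʳ : ∀ h m → mode (h ∷ʳ m) ≡ advance (mode h) m
mode-∷ʳ h m = foldl-∷ʳ advance opening m h

-- Analysis of a play

data RedBlue : Colour → Colour → Set where
  red-blue : RedBlue red blue
  blue-red : RedBlue blue red

p3-012 : ∀ {c} → HasMonoP ((0 , 1 , c) ∷ (1 , 2 , c) ∷ []) c 3
p3-012 = monoP₃ (inj₁ (here refl)) (inj₁ (there (here refl))) (λ ()) (λ ()) (λ ())

p3-013 : ∀ {c d} → HasMonoP ((0 , 1 , c) ∷ (1 , 2 , d) ∷ (1 , 3 , c) ∷ []) c 3
p3-013 = monoP₃ (inj₁ (here refl)) (inj₁ (there (there (here refl)))) (λ ()) (λ ()) (λ ())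

p3-213 : ∀ {c d} → HasMonoP ((0 , 1 , c) ∷ (1 , 2 , d) ∷ (1 , 3 , d) ∷ []) d 3
p3-213 = monoP₃ (inj₂ (there (here refl))) (inj₁ (there (there (here refl)))) (λ ()) (λ ()) (λ ())

6[1+m]∸3 : ∀ m → 6 * suc m ∸ 3 ≡ 6 * m + 3
6[1+m]∸3 m = trans (cong (_∸ 3) (*-suc 6 m)) (+-comm 3 (6 * m))

6[1+m]∸4 : ∀ m → 6 * suc m ∸ 4 ≡ 6 * m + 2
6[1+m]∸4 m = trans (cong (_∸ 4) (*-suc 6 m)) (+-comm 2 (6 * m))

4[1+m]∸2 : ∀ m → 4 * suc m ∸ 2 ≡ 4 * m + 2
4[1+m]∸2 m = trans (cong (_∸ 2) (*-suc 4 m)) (+-comm 2 (4 * m))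

budget-step : ∀ m n t d → n + d ≤ 6 * m + 3 → t ≤ 6 + d → n + t ≤ 6 * suc m + 3
budget-step m n t d n≤ t≤ = begin
  n + t          ≤⟨ +-monoʳ-≤ n t≤ ⟩
  n + (6 + d)    ≡⟨ shuffle n d ⟩
  n + d + 6      ≤⟨ +-monoˡ-≤ 6 n≤ ⟩
  6 * m + 3 + 6  ≡⟨ unfold m ⟩
  6 * suc m + 3  ∎
  where
    open ≤-Reasoning
    shuffle : ∀ n d → n + (6 + d) ≡ n + d + 6
    shuffle = solve-∀
    unfold : ∀ m → 6 * m + 3 + 6 ≡ 6 * suc m + 3
    unfold = solve-∀

length-step : ∀ m {ℓ ℓ′} → ℓ ≡ 4 * m + 2 → ℓ′ ≡ ℓ + 4 → ℓ′ ≡ 4 * suc m + 2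
length-step m refl refl = unfold m
  where
    unfold : ∀ m → 4 * m + 2 + 4 ≡ 4 * suc m + 2
    unfold = solve-∀

bonus-spent : ∀ x n → n + 1 ≤ x + 3 → n ≤ x + 2
bonus-spent x n h = +-cancelʳ-≤ 1 n (x + 2) (subst (n + 1 ≤_) (sym (+-assoc x 2 1)) h)

module Game (P : PainterStrategy) where

  board : ℕ → Board
  board = play builder P

  round : ∀ n {h ms} → board n ≡ h → mode (board n) ≡ ms → ∃ λ c →
          board (suc n) ≡ h ∷ʳ (proj₁ (move ms) , proj₂ (move ms) , c) × mode (board (suc n)) ≡ update ms c
  round n refl refl = _ , play-suc builder P n , trans (cong mode (play-suc builder P n)) (mode-∷ʳ (board n) _)

  consistent : ∀ n → Consistent (board n) (mode (board n))
  consistent zero = refl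
  consistent (suc n) with c , eh , em ← round n refl refl =
    subst₂ Consistent (sym eh) (sym em) (update-consistent _ _ c (consistent n))

  builder-legal : ∀ n → Legal (board n) (builder (board n))
  builder-legal n = legal _ _ (consistent n)

  invariant-at : ∀ n {p} → mode (board n) ≡ startPhase p → PhaseInvariant (board n) p
  invariant-at n {p} em with H , eq , I , _ ← subst (Consistent (board n)) em (consistent n) =
    subst (λ h → PhaseInvariant h p) (sym (trans eq (++-identityʳ H))) I

  PhaseOutcome : ℕ → Phase → Set
  PhaseOutcome n p = (∃ λ t → t ≤ 6 + bonus (status p) × HasP3 (board (n + t)))
                   ⊎ (∃₂ λ t p′ → mode (board (n + t)) ≡ startPhase p′ × length (path p′) ≡ length (path p) + 4
                                  × t + bonus (status p′) ≤ 6 + bonus (status p))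

  module _ (n₀ : ℕ) {H : Board} {p : Phase} (I : PhaseInvariant H p) where
    open AfterLocalMoves I

    descend : ∀ {L} m {ms} → board (suc (n₀ + length L)) ≡ (H ++ mapMoves ⟦ p ⟧ L) ∷ʳ mapMove ⟦ p ⟧ m →
              mode (board (suc (n₀ + length L))) ≡ ms →
              board (n₀ + length (L ∷ʳ m)) ≡ H ++ mapMoves ⟦ p ⟧ (L ∷ʳ m)
              × mode (board (n₀ + length (L ∷ʳ m))) ≡ ms
    descend {L} m eh em rewrite length-++ L {m ∷ []} | +-comm (length L) 1 | +-suc n₀ (length L) =
      trans eh (++-mapMoves-∷ʳ ⟦ p ⟧ H L m) , em

    phase-outcome : ∀ L t → All WellFormedMove L → Certified (status p) L t →
                    board (n₀ + length L) ≡ H ++ mapMoves ⟦ p ⟧ L → mode (board (n₀ + length L)) ≡ next p L t →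
                    PhaseOutcome n₀ p
    phase-outcome L (node u v tg tr tb) wf (legal , okg , okr , okb) eh em with round (n₀ + length L) eh em
    ... | green , eh′ , em′ = uncurry (phase-outcome _ tg (wellFormed-∷ʳ wf legal) okg) (descend _ eh′ em′)
    ... | red , eh′ , em′ = uncurry (phase-outcome _ tr (wellFormed-∷ʳ wf legal) okr) (descend _ eh′ em′)
    ... | blue , eh′ , em′ = uncurry (phase-outcome _ tb (wellFormed-∷ʳ wf legal) okb) (descend _ eh′ em′)
    phase-outcome L (p3 _ _ _ c) _ ok@(ng , _ , _ , _ , _ , _ , t≤) eh _ =
      inj₁ (length L , t≤ , subst HasP3 (sym eh) (nonGreen-P3 c ng (p3-sound L ok)))
    phase-outcome L (pp _ _ c) _ ok@(ng , _ , _ , _ , t≤) eh _ =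
      inj₁ (length L , t≤ , subst HasP3 (sym eh) (nonGreen-P3 c ng (pp-sound L ok)))
    phase-outcome L (done X Y) wf (length≡4 , unique , window , X-linked , Y-linked , t≤) _ em =
      inj₂ (length L , _ , em , Completed.path′-length L wf length≡4 unique window X-linked Y-linked , t≤)

  phase-start : ∀ n {p} → mode (board n) ≡ startPhase p → PhaseOutcome n p
  phase-start n {p} em with winning (status p)
  ... | is-node , ok = phase-outcome n (invariant-at n em) [] (strategy (status p)) [] ok
      (trans (cong board (+-identityʳ n)) (sym (++-identityʳ (board n))))
      (trans (cong (mode ∘′ board) (+-identityʳ n)) (trans em (sym (next-node is-node))))

  Progress : ℕ → Set
  Progress m = (∃ λ n → n ≤ 6 * m + 3 × HasP3 (board n))
             ⊎ (∃₂ λ n p → mode (board n) ≡ startPhase p × length (path p) ≡ 4 * m + 2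
                           × n + bonus (status p) ≤ 6 * m + 3)

  found : ∀ n {h} → n ≤ 3 → board n ≡ h → HasP3 h → Progress 0
  found n n≤3 eh has = inj₁ (n , n≤3 , subst HasP3 (sym eh) has)

  begun : ∀ n {p} → mode (board n) ≡ startPhase p → length (path p) ≡ 2 → n + bonus (status p) ≤ 3 → Progress 0
  begun n em length≡2 n≤3 = inj₂ (n , _ , em , length≡2 , n≤3)

  after-two-edges : ∀ {c d} → RedBlue c d → board 2 ≡ (0 , 1 , c) ∷ (1 , 2 , d) ∷ [] →
                    mode (board 2) ≡ twoEdges c d → Progress 0
  after-two-edges rb eh em with round 2 eh em
  after-two-edges red-blue _ _ | green , _ , em′ = begun 3 em′ refl ≤-refl
  after-two-edges blue-red _ _ | green , _ , em′ = begun 3 em′ refl ≤-refl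
  after-two-edges red-blue _ _ | red , eh′ , _ = found 3 ≤-refl eh′ (inj₁ p3-013)
  after-two-edges red-blue _ _ | blue , eh′ , _ = found 3 ≤-refl eh′ (inj₂ p3-213)
  after-two-edges blue-red _ _ | red , eh′ , _ = found 3 ≤-refl eh′ (inj₁ p3-213)
  after-two-edges blue-red _ _ | blue , eh′ , _ = found 3 ≤-refl eh′ (inj₂ p3-013)

  after-one-edge : ∀ c → NonGreen c → board 1 ≡ (0 , 1 , c) ∷ [] → mode (board 1) ≡ oneEdge c → Progress 0
  after-one-edge green ()
  after-one-edge c _ eh em with round 1 eh em
  after-one-edge red _ _ _ | green , _ , em′ = begun 2 em′ refl (s≤s (s≤s z≤n))
  after-one-edge blue _ _ _ | green , _ , em′ = begun 2 em′ refl (s≤s (s≤s z≤n))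
  after-one-edge red _ _ _ | red , eh′ , _ = found 2 (s≤s (s≤s z≤n)) eh′ (inj₁ p3-012)
  after-one-edge blue _ _ _ | blue , eh′ , _ = found 2 (s≤s (s≤s z≤n)) eh′ (inj₂ p3-012)
  after-one-edge red _ _ _ | blue , eh′ , em′ = after-two-edges red-blue eh′ em′
  after-one-edge blue _ _ _ | red , eh′ , em′ = after-two-edges blue-red eh′ em′

  opening-progress : Progress 0
  opening-progress with round 0 refl refl
  ... | green , _ , em = begun 1 em refl (s≤s (s≤s z≤n))
  ... | red , eh , em = after-one-edge red tt eh em
  ... | blue , eh , em = after-one-edge blue tt eh em

  progress : ∀ m → Progress m
  progress zero = opening-progress
  progress (suc m) with progress m
  ... | inj₁ (n , n≤ , has) = inj₁ (n , ≤-trans n≤ (+-monoˡ-≤ 3 (*-monoʳ-≤ 6 (n≤1+n m))) , has)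
  ... | inj₂ (n , p , em , length≡ , n≤) with phase-start n em
  ...   | inj₁ (t , t≤ , has) = inj₁ (n + t , budget-step m n t _ n≤ t≤ , has)
  ...   | inj₂ (t , p′ , em′ , length≡′ , t≤) = inj₂ (n + t , p′ , em′ , length-step m length≡ length≡′ ,
          ≤-trans (≤-reflexive (+-assoc n t _)) (budget-step m n _ _ n≤ t≤))

  path-found : ∀ m n {p} → PhaseInvariant (board n) p → length (path p) ≡ 4 * m + 2 →
               n + bonus (status p) ≤ 6 * m + 3 →
               (∃ λ n → n ≤ 6 * suc m ∸ 4 × HasBadGreenP (board n) (4 * suc m ∸ 2))
               ⊎ (∃ λ n → n ≤ 6 * suc m ∸ 3 × HasGoodGreenP (board n) (4 * suc m ∸ 2))
  path-found m n {p} I length≡ n≤ with PhaseFacts.good-or-bad I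
  ... | inj₁ good = inj₂ (n , subst (n ≤_) (sym (6[1+m]∸3 m)) (≤-trans (m≤m+n n _) n≤) , path p , green-path , good)
    where open PhaseFacts I
          green-path = monoPath (trans length≡ (sym (4[1+m]∸2 m)))
  ... | inj₂ (bad , bonus≡1) = inj₁ (n , subst (n ≤_) (sym (6[1+m]∸4 m)) n≤′ , path p , green-path , bad)
    where open PhaseFacts I
          green-path = monoPath (trans length≡ (sym (4[1+m]∸2 m)))
          n≤′ = bonus-spent (6 * m) n (subst (λ d → n + d ≤ 6 * m + 3) bonus≡1 n≤)

  conclusion : ∀ m → (∃ λ n → n ≤ 6 * suc m ∸ 3 × HasP3 (board n))
                   ⊎ (∃ λ n → n ≤ 6 * suc m ∸ 4 × HasBadGreenP (board n) (4 * suc m ∸ 2))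
                   ⊎ (∃ λ n → n ≤ 6 * suc m ∸ 3 × HasGoodGreenP (board n) (4 * suc m ∸ 2))
  conclusion m with progress m
  ... | inj₁ (n , n≤ , has) = inj₁ (n , subst (n ≤_) (sym (6[1+m]∸3 m)) n≤ , has)
  ... | inj₂ (n , p , em , length≡ , n≤) = inj₂ (path-found m n (invariant-at n em) length≡ n≤)

theorem3p10 : (k : ℕ) → 1 ≤ k →
    Σ BuilderStrategy λ B → (P : PainterStrategy) →
      ((n : ℕ) → n < 6 * k ∸ 3 → Legal (play B P n) (B (play B P n)))
      × ((∃ λ n → n ≤ 6 * k ∸ 3 × (HasMonoP (play B P n) red 3 ⊎ HasMonoP (play B P n) blue 3))
         ⊎ (∃ λ n → n ≤ 6 * k ∸ 4 × HasBadGreenP (play B P n) (4 * k ∸ 2))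
         ⊎ (∃ λ n → n ≤ 6 * k ∸ 3 × HasGoodGreenP (play B P n) (4 * k ∸ 2)))
theorem3p10 (suc m) _ = builder , λ P → (λ n _ → Game.builder-legal P n) , Game.conclusion P m
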